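{- As formal power series, $$\mathcal{G}^{**}(x,s,u)=\mathcal{N}(x,us)\left(\mathcal{G}^*(x,s,u)-\frac{x}{1-x}\cdot\frac{s}{1-s}\right).$$
   Context: For positive integers $n,p$, $\mathbf{I}_{n,p}$ is the set of integer sequences $(e_1,\dots,e_n)$ with $0\le e_1<p$ and $0\le e_i<p+i$ for $2\le i\le n$; $\mathbf{N}_n$ is the set of all sequences of $n$ nonnegative integers. For a sequence $e$: $\mathsf{lar}(e)=\max_i e_i$, $\mathsf{sma}(e)=\min_i e_i$, $\mathsf{R}_{\mathsf{lar}}(e)=\max\{i:e_i=\mathsf{lar}(e)\}$, $\mathsf{R}_{\mathsf{sma}}(e)=\max\{i:e_i=\mathsf{sma}(e)\}$, $\mathsf{asc}(e)=|\{i:e_i<e_{i+1}\}|$. $\mathbf{SL}_{n,p}=\{e\in\mathbf{I}_{n,p}:\mathsf{R}_{\mathsf{lar}}(e)\ge\mathsf{R}_{\mathsf{sma}}(e)\}$, $\mathbf{LS}_{n,p}=\{e\in\mathbf{I}_{n,p}:\mathsf{R}_{\mathsf{lar}}(e)<\mathsf{R}_{\mathsf{sma}}(e)\}$. For a set $X$ of sequences, $X(021)$ denotes those $e\in X$ with no indices $i<j<k$ such that $e_i<e_k<e_j$. Define $\mathcal{N}(x,u)=\sum_{n\ge1}x^n\sum_{w\in\mathbf{N}_n(021)}u^{\mathsf{lar}(w)}t^{\mathsf{asc}(w)}$, $\mathcal{G}^*(x,s,u)=\sum_{p\ge1}\sum_{n\ge1}x^ns^p\sum_{e\in\mathbf{SL}_{n,p}(021)}u^{\mathsf{lar}(e)}t^{\mathsf{asc}(e)}$,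 $\mathcal{G}^{**}(x,s,u)=\sum_{p\ge1}\sum_{n\ge1}x^ns^p\sum_{e\in\mathbf{LS}_{n,p}(021)}u^{\mathsf{lar}(e)}t^{\mathsf{asc}(e)}$. -}

module Defs where

open import Data.Bool using (Bool; true; false; if_then_else_; _∧_; _∨_; not)
open import Data.Nat using (ℕ; zero; suc; _+_; _*_; _∸_; _⊔_; _⊓_; _≡ᵇ_; _<ᵇ_; _≤ᵇ_)
open import Data.List using (List; []; _∷_; map; upTo; concatMap; filterᵇ; length; replicate; foldl; zip)
open import Data.Bool.ListAction using (any)
open import Data.Product using (_,_; _×_)
open import Data.Integer as ℤ using (ℤ; +_)

-- largest entry (sequences considered are nonempty)
lar : List ℕ → ℕ
lar []       = 0
lar (x ∷ xs) = x ⊔ lar xs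

sma : List ℕ → ℕ
sma []           = 0
sma (x ∷ [])     = x
sma (x ∷ y ∷ ys) = x ⊓ sma (y ∷ ys)

-- largest (1-based) position i with e_i = v  (0 if none)
lastPos : ℕ → List ℕ → ℕ
lastPos v e = foldl step 0 (zip (map suc (upTo (length e))) e)
  where
  step : ℕ → ℕ × ℕ → ℕ
  step acc (i , x) = if x ≡ᵇ v then i else acc

Rlar : List ℕ → ℕ
Rlar e = lastPos (lar e) e

Rsma : List ℕ → ℕ
Rsma e = lastPos (sma e) e

asc : List ℕ → ℕ
asc (x ∷ y ∷ r) = (if x <ᵇ y then 1 else 0) + asc (y ∷ r)
asc _           = 0

-- does e contain i<j<k with e_i < e_k < e_j ?  (pattern 021)
-- pairFrom x ys : exist j<k in ys with x < ys_k < ys_j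
pairFrom : ℕ → List ℕ → Bool
pairFrom x []       = false
pairFrom x (y ∷ zs) = any (λ z → (x <ᵇ z) ∧ (z <ᵇ y)) zs ∨ pairFrom x zs

contains021 : List ℕ → Bool
contains021 []       = false
contains021 (x ∷ xs) = pairFrom x xs ∨ contains021 xs

avoids021 : List ℕ → Bool
avoids021 e = not (contains021 e)

box : List ℕ → List (List ℕ)
box []       = [] ∷ []
box (b ∷ bs) = concatMap (λ x → map (x ∷_) (box bs)) (upTo b)

-- I_{n,p} for n ≥ 1 : bounds p, p+2, p+3, ..., p+n
Ibounds : ℕ → ℕ → List ℕ
Ibounds n p = p ∷ map (λ i → p + suc (suc i)) (upTo (n ∸ 1))

I : ℕ → ℕ → List (List ℕ)
I n p = box (Ibounds n p)

-- sequences in N_n with all entries ≤ k (every w ∈ N_n with lar w = k is here)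
Nk : ℕ → ℕ → List (List ℕ)
Nk n k = box (replicate n (suc k))

count : (List ℕ → Bool) → List (List ℕ) → ℕ
count P xs = length (filterᵇ P xs)

-- Formal power series in x, s, u, t with integer coefficients:
-- F n p k a = coefficient of x^n s^p u^k t^a.

PS : Set
PS = ℕ → ℕ → ℕ → ℕ → ℤ

Σ≤ : ℕ → (ℕ → ℤ) → ℤ
Σ≤ n f = Data.List.foldr ℤ._+_ (+ 0) (map f (upTo (suc n)))

_*ₚ_ : PS → PS → PS
(F *ₚ G) n p k a =
  Σ≤ n λ n₁ → Σ≤ p λ p₁ → Σ≤ k λ k₁ → Σ≤ a λ a₁ →
    F n₁ p₁ k₁ a₁ ℤ.* G (n ∸ n₁) (p ∸ p₁) (k ∸ k₁) (a ∸ a₁)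

_-ₚ_ : PS → PS → PS
(F -ₚ G) n p k a = F n p k a ℤ.- G n p k a

infixl 7 _*ₚ_
infixl 6 _-ₚ_

-- 𝒩(x,u) = Σ_{n≥1} x^n Σ_{w ∈ N_n(021)} u^{lar w} t^{asc w}
-- coefficient of x^n u^k t^a
𝒩coef : ℕ → ℕ → ℕ → ℤ
𝒩coef zero    k a = + 0
𝒩coef (suc m) k a =
  + count (λ w → avoids021 w ∧ (lar w ≡ᵇ k) ∧ (asc w ≡ᵇ a)) (Nk (suc m) k)

𝒩us : PS
𝒩us n p k a = if p ≡ᵇ k then 𝒩coef n k a else + 0

-- 𝒢*(x,s,u): sum over SL_{n,p}(021), n,p ≥ 1
𝒢* : PS
𝒢* zero    p       k a = + 0
𝒢* (suc m) zero    k a = + 0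
𝒢* (suc m) (suc q) k a =
  + count (λ e → avoids021 e ∧ (Rsma e ≤ᵇ Rlar e) ∧ (lar e ≡ᵇ k) ∧ (asc e ≡ᵇ a))
          (I (suc m) (suc q))

-- 𝒢**(x,s,u): sum over LS_{n,p}(021), n,p ≥ 1
𝒢** : PS
𝒢** zero    p       k a = + 0
𝒢** (suc m) zero    k a = + 0
𝒢** (suc m) (suc q) k a =
  + count (λ e → avoids021 e ∧ (Rlar e <ᵇ Rsma e) ∧ (lar e ≡ᵇ k) ∧ (asc e ≡ᵇ a))
          (I (suc m) (suc q))

x/1-x : PS
x/1-x (suc _) zero zero zero = + 1
x/1-x _       _    _    _    = + 0

s/1-s : PS
s/1-s zero (suc _) zero zero = + 1
s/1-s _    _       _    _    = + 0

{-# OPTIONS --safe #-}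
-- Cut an LS sequence e right after the last occurrence of its maximum M, e = x ++ y, so that
-- x ends in M and every entry of y is below M.  Avoiding 021 forces every entry of x to be at
-- least L = lar y, and this is the only interaction between the parts: x shifted down by L is
-- an SL sequence (an SL sequence avoiding 021 ends with its maximum) with positive maximum in
-- I_{|x|, p - L}, while y is any 021-avoiding sequence with maximum L (its bounds exceed p > L),
-- and asc e = asc x + asc y.  Summing over the cut, L and asc y gives 𝒩(x, us) · G*⁺, where
-- G*⁺ is 𝒢* without its lar = 0 terms; those come from the sequences 0…0 and add up to
-- x/(1-x) · s/(1-s).
module Submission where

open import Defs
open import Data.Bool using (Bool; true; false; if_then_else_; _∧_; _∨_; not; T)
open import Data.Bool.ListAction using (any; all)
import Data.Bool.Properties as Boolₚ
open import Data.Nat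
open import Data.Nat.Properties
open import Data.Integer as ℤ using (ℤ)
import Data.Integer.Properties as ℤₚ
open import Data.List using (List; []; _∷_; _++_; [_]; map; length; replicate; upTo; applyUpTo; concatMap; foldl; foldr; zip)
import Data.List.Properties as Listₚ
open import Data.List.Relation.Unary.All as All using (All; []; _∷_)
import Data.List.Relation.Unary.All.Properties as Allₚ
open import Data.Product using (_×_; _,_; proj₁; proj₂; Σ-syntax)
open import Data.Sum using (inj₁; inj₂)
open import Data.Empty using (⊥-elim)
open import Function using (_∘_; Equivalence)
open import Relation.Binary.PropositionalEquality hiding ([_])
open import Relation.Nullary using (yes; no)

T⇒≡true : ∀ {b} → T b → b ≡ true
T⇒≡true = Equivalence.to Boolₚ.T-≡

≡true⇒T : ∀ {b} → b ≡ true → T b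
≡true⇒T = Equivalence.from Boolₚ.T-≡

≡ᵇ-true⇒≡ : ∀ {m n} → (m ≡ᵇ n) ≡ true → m ≡ n
≡ᵇ-true⇒≡ {m} {n} h = ≡ᵇ⇒≡ m n (≡true⇒T h)

<ᵇ-true⇒< : ∀ {m n} → (m <ᵇ n) ≡ true → m < n
<ᵇ-true⇒< {m} {n} h = <ᵇ⇒< m n (≡true⇒T h)

≤ᵇ-true⇒≤ : ∀ {m n} → (m ≤ᵇ n) ≡ true → m ≤ n
≤ᵇ-true⇒≤ {m} {n} h = ≤ᵇ⇒≤ m n (≡true⇒T h)

≡⇒≡ᵇ-true : ∀ {m n} → m ≡ n → (m ≡ᵇ n) ≡ true
≡⇒≡ᵇ-true {m} {n} h = T⇒≡true (≡⇒≡ᵇ m n h)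

<⇒<ᵇ-true : ∀ {m n} → m < n → (m <ᵇ n) ≡ true
<⇒<ᵇ-true h = T⇒≡true (<⇒<ᵇ h)

≤⇒≤ᵇ-true : ∀ {m n} → m ≤ n → (m ≤ᵇ n) ≡ true
≤⇒≤ᵇ-true h = T⇒≡true (≤⇒≤ᵇ h)

≡ᵇ-refl : ∀ n → (n ≡ᵇ n) ≡ true
≡ᵇ-refl n = ≡⇒≡ᵇ-true {n} refl

≢⇒≡ᵇ-false : ∀ {m n} → m ≢ n → (m ≡ᵇ n) ≡ false
≢⇒≡ᵇ-false {m} {n} m≢n with m ≡ᵇ n in eq
... | false = refl
... | true = ⊥-elim (m≢n (≡ᵇ-true⇒≡ eq))

≥⇒<ᵇ-false : ∀ {m n} → n ≤ m → (m <ᵇ n) ≡ false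
≥⇒<ᵇ-false {m} {n} n≤m with m <ᵇ n in eq
... | false = refl
... | true = ⊥-elim (<⇒≱ (<ᵇ-true⇒< eq) n≤m)

≰⇒≤ᵇ-false : ∀ {m n} → m ≰ n → (m ≤ᵇ n) ≡ false
≰⇒≤ᵇ-false {m} {n} m≰n with m ≤ᵇ n in eq
... | false = refl
... | true = ⊥-elim (m≰n (≤ᵇ-true⇒≤ eq))

∧-true-intro : ∀ {a b} → a ≡ true → b ≡ true → a ∧ b ≡ true
∧-true-intro refl refl = refl

∧-true-elim : ∀ a {b} → a ∧ b ≡ true → a ≡ true × b ≡ true
∧-true-elim true {true} _ = refl , refl

∨-false-elim : ∀ a {b} → a ∨ b ≡ false → a ≡ false × b ≡ false
∨-false-elim false {false} _ = refl , refl

∨-true-introˡ : ∀ {a} b → a ≡ true → a ∨ b ≡ true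
∨-true-introˡ b refl = refl

∨-true-introʳ : ∀ a {b} → b ≡ true → a ∨ b ≡ true
∨-true-introʳ a refl = Boolₚ.∨-zeroʳ a

not-true-elim : ∀ {b} → not b ≡ true → b ≡ false
not-true-elim {false} _ = refl

not-true-intro : ∀ {b} → b ≡ false → not b ≡ true
not-true-intro refl = refl

Bool-ext : ∀ {b c} → (b ≡ true → c ≡ true) → (c ≡ true → b ≡ true) → b ≡ c
Bool-ext {true} f g = sym (f refl)
Bool-ext {false} {false} f g = refl
Bool-ext {false} {true} f g = g refl

occurs : ℕ → List ℕ → Bool
occurs v = any (_≡ᵇ v)

-- 0-based index of the last occurrence of v (0 when v does not occur)
lastIndex : ℕ → List ℕ → ℕ
lastIndex v []       = 0
lastIndex v (z ∷ zs) = if occurs v zs then suc (lastIndex v zs) else 0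

occurs-here : ∀ v x xs → x ≡ v → occurs v (x ∷ xs) ≡ true
occurs-here v x xs refl rewrite ≡ᵇ-refl x = refl

occurs-there : ∀ v x xs → occurs v xs ≡ true → occurs v (x ∷ xs) ≡ true
occurs-there v x xs h = ∨-true-introʳ (x ≡ᵇ v) h

occurs-++ : ∀ v xs ys → occurs v (xs ++ ys) ≡ occurs v xs ∨ occurs v ys
occurs-++ v []       ys = refl
occurs-++ v (x ∷ xs) ys rewrite occurs-++ v xs ys = sym (Boolₚ.∨-assoc (x ≡ᵇ v) _ _)

occurs-++ʳ : ∀ {v} xs {ys} → occurs v ys ≡ true → occurs v (xs ++ ys) ≡ true
occurs-++ʳ {v} xs {ys} h rewrite occurs-++ v xs ys | h = Boolₚ.∨-zeroʳ _

All-occurs : ∀ {P : ℕ → Set} {v} e → All P e → occurs v e ≡ true → P v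
All-occurs {P} {v} (x ∷ xs) (px ∷ pxs) h with x ≡ᵇ v in eq
... | true  = subst P (≡ᵇ-true⇒≡ eq) px
... | false = All-occurs xs pxs h

All<⇒¬occurs : ∀ {v} e → All (_< v) e → occurs v e ≡ false
All<⇒¬occurs []       []       = refl
All<⇒¬occurs {v} (x ∷ xs) (x<v ∷ xs<v) rewrite All<⇒¬occurs xs xs<v
  | ≢⇒≡ᵇ-false (<⇒≢ x<v) = refl

¬occurs⇒All< : ∀ {v} e → occurs v e ≡ false → All (_≤ v) e → All (_< v) e
¬occurs⇒All< []       _ [] = []
¬occurs⇒All< {v} (x ∷ xs) h (x≤v ∷ xs≤v) with ∨-false-elim (x ≡ᵇ v) h
... | x≢v , v∉xs =
  ≤∧≢⇒< x≤v (λ x≡v → Boolₚ.not-¬ (≡⇒≡ᵇ-true x≡v) x≢v) ∷ ¬occurs⇒All< xs v∉xs xs≤v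

lastIndex-++-occurs : ∀ v xs ys → occurs v ys ≡ true → lastIndex v (xs ++ ys) ≡ length xs + lastIndex v ys
lastIndex-++-occurs v []       ys h = refl
lastIndex-++-occurs v (x ∷ xs) ys h rewrite occurs-++ʳ {v} xs {ys} h =
  cong suc (lastIndex-++-occurs v xs ys h)

lastIndex-¬occurs : ∀ v ys → occurs v ys ≡ false → lastIndex v ys ≡ 0
lastIndex-¬occurs v []       h = refl
lastIndex-¬occurs v (y ∷ ys) h rewrite proj₂ (∨-false-elim (y ≡ᵇ v) h) = refl

lastIndex-++-¬occurs : ∀ v xs ys → occurs v ys ≡ false → lastIndex v (xs ++ ys) ≡ lastIndex v xs
lastIndex-++-¬occurs v []       ys h = lastIndex-¬occurs v ys h
lastIndex-++-¬occurs v (x ∷ xs) ys h rewrite occurs-++ v xs ys | h | Boolₚ.∨-identityʳ (occurs v xs)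
  with occurs v xs
... | true  = cong suc (lastIndex-++-¬occurs v xs ys h)
... | false = refl

lastIndex<length : ∀ v z zs → lastIndex v (z ∷ zs) ≤ length zs
lastIndex<length v z []       = z≤n
lastIndex<length v z (y ∷ ys) with occurs v (y ∷ ys)
... | true  = s≤s (lastIndex<length v y ys)
... | false = z≤n

lastPos-lastIndex : ∀ v e → lastPos v e ≡ (if occurs v e then suc (lastIndex v e) else 0)
lastPos-lastIndex v e =
  trans (cong (λ is → foldl step 0 (zip is e)) (Listₚ.map-upTo suc (length e))) (go suc 0 e)
  where
  step : ℕ → ℕ × ℕ → ℕ
  step acc (i , x) = if x ≡ᵇ v then i else acc
  go : ∀ (pos : ℕ → ℕ) acc e → foldl step acc (zip (applyUpTo pos (length e)) e)
                              ≡ (if occurs v e then pos (lastIndex v e) else acc)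
  go pos acc []       = refl
  go pos acc (z ∷ zs) with go (pos ∘ suc) (if z ≡ᵇ v then pos 0 else acc) zs
  ... | ih with occurs v zs | z ≡ᵇ v
  ... | true  | true  = ih
  ... | true  | false = ih
  ... | false | true  = ih
  ... | false | false = ih

lastPos≤length : ∀ v e → lastPos v e ≤ length e
lastPos≤length v []       = z≤n
lastPos≤length v (z ∷ zs) rewrite lastPos-lastIndex v (z ∷ zs) with occurs v (z ∷ zs)
... | true  = s≤s (lastIndex<length v z zs)
... | false = z≤n

lastPos-++-occurs : ∀ v xs ys → occurs v ys ≡ true → length xs < lastPos v (xs ++ ys)
lastPos-++-occurs v xs ys h rewrite lastPos-lastIndex v (xs ++ ys) | occurs-++ʳ {v} xs {ys} h
  | lastIndex-++-occurs v xs ys h = s≤s (m≤m+n (length xs) _)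

lastPos-++-¬occurs : ∀ v xs ys → occurs v ys ≡ false → lastPos v (xs ++ ys) ≡ lastPos v xs
lastPos-++-¬occurs v xs ys h rewrite lastPos-lastIndex v (xs ++ ys) | lastPos-lastIndex v xs
  | occurs-++ v xs ys | h | Boolₚ.∨-identityʳ (occurs v xs) | lastIndex-++-¬occurs v xs ys h = refl

lastPos-∷-occurs : ∀ v z zs → occurs v zs ≡ true → lastPos v (z ∷ zs) ≡ suc (lastPos v zs)
lastPos-∷-occurs v z zs h rewrite lastPos-lastIndex v (z ∷ zs) | lastPos-lastIndex v zs | h
  | Boolₚ.∨-zeroʳ (z ≡ᵇ v) = refl

lastPos-∷-¬occurs : ∀ v z zs → occurs v zs ≡ false → (z ≡ᵇ v) ≡ true → lastPos v (z ∷ zs) ≡ 1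
lastPos-∷-¬occurs v z zs h z≡v rewrite lastPos-lastIndex v (z ∷ zs) | h | z≡v = refl

lastPos-occurs>0 : ∀ v e → occurs v e ≡ true → (lastPos v e ≡ᵇ 0) ≡ false
lastPos-occurs>0 v e h rewrite lastPos-lastIndex v e | h = refl

splitAtLast : ∀ v e → occurs v e ≡ true →
  Σ[ u ∈ List ℕ ] Σ[ t ∈ List ℕ ] e ≡ u ++ v ∷ t × occurs v t ≡ false × lastPos v e ≡ suc (length u)
splitAtLast v (z ∷ zs) h with occurs v zs in eq
... | true with splitAtLast v zs eq
...   | u , t , refl , t∌v , pos = z ∷ u , t , refl , t∌v , trans (lastPos-∷-occurs v z (u ++ v ∷ t) eq) (cong suc pos)
splitAtLast v (z ∷ zs) h | false =
  [] , zs , cong (_∷ zs) (≡ᵇ-true⇒≡ z≡v) , eq , lastPos-∷-¬occurs v z zs eq z≡v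
  where
  z≡v : (z ≡ᵇ v) ≡ true
  z≡v = trans (sym (Boolₚ.∨-identityʳ (z ≡ᵇ v))) h

lar-++ : ∀ xs ys → lar (xs ++ ys) ≡ lar xs ⊔ lar ys
lar-++ []       ys = refl
lar-++ (x ∷ xs) ys rewrite lar-++ xs ys = sym (⊔-assoc x (lar xs) (lar ys))

All≤lar : ∀ e → All (_≤ lar e) e
All≤lar []       = []
All≤lar (x ∷ xs) = m≤m⊔n x (lar xs) ∷ All.map (λ h → ≤-trans h (m≤n⊔m x (lar xs))) (All≤lar xs)

occurs-lar : ∀ x xs → occurs (lar (x ∷ xs)) (x ∷ xs) ≡ true
occurs-lar x []       = occurs-here _ x [] (sym (⊔-identityʳ x))
occurs-lar x (y ∷ ys) with ⊔-sel x (lar (y ∷ ys))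
... | inj₁ eq rewrite eq = occurs-here x x (y ∷ ys) refl
... | inj₂ eq rewrite eq = occurs-there (lar (y ∷ ys)) x (y ∷ ys) (occurs-lar y ys)

occurs-sma : ∀ x xs → occurs (sma (x ∷ xs)) (x ∷ xs) ≡ true
occurs-sma x []       = occurs-here x x [] refl
occurs-sma x (y ∷ ys) with ⊓-sel x (sma (y ∷ ys))
... | inj₁ eq rewrite eq = occurs-here x x (y ∷ ys) refl
... | inj₂ eq rewrite eq = occurs-there (sma (y ∷ ys)) x (y ∷ ys) (occurs-sma y ys)

sma≤lar : ∀ y ys → sma (y ∷ ys) ≤ lar (y ∷ ys)
sma≤lar y ys = All-occurs (y ∷ ys) (All≤lar (y ∷ ys)) (occurs-sma y ys)

asc-++ : ∀ xs ys → All (lar ys ≤_) xs → asc (xs ++ ys) ≡ asc xs + asc ys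
asc-++ []           ys      h        = refl
asc-++ (u ∷ [])     []      h        = refl
asc-++ (u ∷ [])     (y ∷ r) (h ∷ []) rewrite ≥⇒<ᵇ-false (≤-trans (m≤m⊔n y (lar r)) h) = refl
asc-++ (u ∷ u′ ∷ r) ys      (h ∷ hs) rewrite asc-++ (u′ ∷ r) ys hs =
  sym (+-assoc (if u <ᵇ u′ then 1 else 0) (asc (u′ ∷ r)) (asc ys))

any-++ : (P : ℕ → Bool) → ∀ xs ys → any P (xs ++ ys) ≡ any P xs ∨ any P ys
any-++ P []       ys = refl
any-++ P (x ∷ xs) ys rewrite any-++ P xs ys = sym (Boolₚ.∨-assoc (P x) _ _)

any-false : (P : ℕ → Bool) → ∀ {ys} → All (λ t → P t ≡ false) ys → any P ys ≡ false
any-false P []       = refl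
any-false P (h ∷ hs) rewrite h | any-false P hs = refl

any-true : (P : ℕ → Bool) → ∀ r {t} s → P t ≡ true → any P (r ++ t ∷ s) ≡ true
any-true P []      s h rewrite h = refl
any-true P (x ∷ r) s h = ∨-true-introʳ (P x) (any-true P r s h)

pairFrom-below : ∀ x ys → All (_≤ x) ys → pairFrom x ys ≡ false
pairFrom-below x []       []       = refl
pairFrom-below x (y ∷ zs) (h ∷ hs) rewrite pairFrom-below x zs hs
  | any-false (λ z → (x <ᵇ z) ∧ (z <ᵇ y)) (All.map (λ {t} t≤x → cong (_∧ (t <ᵇ y)) (≥⇒<ᵇ-false t≤x)) hs) = refl

pairFrom-++-below : ∀ x zs ys → All (_≤ x) ys → pairFrom x (zs ++ ys) ≡ pairFrom x zs
pairFrom-++-below x []       ys h = pairFrom-below x ys h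
pairFrom-++-below x (z ∷ zs) ys h rewrite pairFrom-++-below x zs ys h
  | any-++ (λ t → (x <ᵇ t) ∧ (t <ᵇ z)) zs ys
  | any-false (λ t → (x <ᵇ t) ∧ (t <ᵇ z)) (All.map (λ {t} t≤x → cong (_∧ (t <ᵇ z)) (≥⇒<ᵇ-false t≤x)) h)
  | Boolₚ.∨-identityʳ (any (λ t → (x <ᵇ t) ∧ (t <ᵇ z)) zs) = refl

contains021-++ : ∀ xs ys → All (lar ys ≤_) xs → contains021 (xs ++ ys) ≡ contains021 xs ∨ contains021 ys
contains021-++ []       ys h        = refl
contains021-++ (x ∷ xs) ys (h ∷ hs) rewrite contains021-++ xs ys hs
  | pairFrom-++-below x xs ys (All.map (λ t≤L → ≤-trans t≤L h) (All≤lar ys)) =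
  sym (Boolₚ.∨-assoc (pairFrom x xs) _ _)

contains021-witness : ∀ p u q M r t s → u < t → t < M → contains021 (p ++ u ∷ q ++ M ∷ r ++ t ∷ s) ≡ true
contains021-witness []      u q M r t s u<t t<M = ∨-true-introˡ _ (pairFrom-witness q)
  where
  pairFrom-witness : ∀ q → pairFrom u (q ++ M ∷ r ++ t ∷ s) ≡ true
  pairFrom-witness []      = ∨-true-introˡ _ (any-true _ r s (cong₂ _∧_ (<⇒<ᵇ-true u<t) (<⇒<ᵇ-true t<M)))
  pairFrom-witness (x ∷ q) = ∨-true-introʳ _ (pairFrom-witness q)
contains021-witness (x ∷ p) u q M r t s u<t t<M = ∨-true-introʳ _ (contains021-witness p u q M r t s u<t t<M)

shift : ℕ → List ℕ → List ℕ
shift k = map (k +_)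

<ᵇ-+ˡ : ∀ k x y → (k + x <ᵇ k + y) ≡ (x <ᵇ y)
<ᵇ-+ˡ zero    x y = refl
<ᵇ-+ˡ (suc k) x y = <ᵇ-+ˡ k x y

≡ᵇ-+ˡ : ∀ k x y → (k + x ≡ᵇ k + y) ≡ (x ≡ᵇ y)
≡ᵇ-+ˡ zero    x y = refl
≡ᵇ-+ˡ (suc k) x y = ≡ᵇ-+ˡ k x y

lar-shift : ∀ k x xs → lar (shift k (x ∷ xs)) ≡ k + lar (x ∷ xs)
lar-shift k x []       rewrite ⊔-identityʳ (k + x) | ⊔-identityʳ x = refl
lar-shift k x (y ∷ ys) rewrite lar-shift k y ys = sym (+-distribˡ-⊔ k x (lar (y ∷ ys)))

sma-shift : ∀ k x xs → sma (shift k (x ∷ xs)) ≡ k + sma (x ∷ xs)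
sma-shift k x []       = refl
sma-shift k x (y ∷ ys) rewrite sma-shift k y ys = sym (+-distribˡ-⊓ k x (sma (y ∷ ys)))

asc-shift : ∀ k e → asc (shift k e) ≡ asc e
asc-shift k []           = refl
asc-shift k (x ∷ [])     = refl
asc-shift k (x ∷ y ∷ ys) = cong₂ (λ b r → (if b then 1 else 0) + r) (<ᵇ-+ˡ k x y) (asc-shift k (y ∷ ys))

any-shift : ∀ k (P Q : ℕ → Bool) → (∀ t → P (k + t) ≡ Q t) → ∀ ys → any P (shift k ys) ≡ any Q ys
any-shift k P Q h []       = refl
any-shift k P Q h (y ∷ ys) rewrite h y | any-shift k P Q h ys = refl

pairFrom-shift : ∀ k x ys → pairFrom (k + x) (shift k ys) ≡ pairFrom x ys
pairFrom-shift k x []       = refl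
pairFrom-shift k x (y ∷ zs) rewrite pairFrom-shift k x zs
  | any-shift k (λ z → (k + x <ᵇ z) ∧ (z <ᵇ k + y)) (λ z → (x <ᵇ z) ∧ (z <ᵇ y))
              (λ t → cong₂ _∧_ (<ᵇ-+ˡ k x t) (<ᵇ-+ˡ k t y)) zs = refl

contains021-shift : ∀ k e → contains021 (shift k e) ≡ contains021 e
contains021-shift k []       = refl
contains021-shift k (x ∷ xs) rewrite pairFrom-shift k x xs | contains021-shift k xs = refl

occurs-shift : ∀ k v e → occurs (k + v) (shift k e) ≡ occurs v e
occurs-shift k v = any-shift k (_≡ᵇ k + v) (_≡ᵇ v) (λ t → ≡ᵇ-+ˡ k t v)

lastIndex-shift : ∀ k v e → lastIndex (k + v) (shift k e) ≡ lastIndex v e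
lastIndex-shift k v []       = refl
lastIndex-shift k v (x ∷ xs) rewrite occurs-shift k v xs | lastIndex-shift k v xs = refl

lastPos-shift : ∀ k v e → lastPos (k + v) (shift k e) ≡ lastPos v e
lastPos-shift k v e rewrite lastPos-lastIndex (k + v) (shift k e) | lastPos-lastIndex v e
  | occurs-shift k v e | lastIndex-shift k v e = refl

isSL isLS : ℕ → ℕ → List ℕ → Bool
isSL k a e = avoids021 e ∧ (Rsma e ≤ᵇ Rlar e) ∧ (lar e ≡ᵇ k) ∧ (asc e ≡ᵇ a)
isLS k a e = avoids021 e ∧ (Rlar e <ᵇ Rsma e) ∧ (lar e ≡ᵇ k) ∧ (asc e ≡ᵇ a)

isN : ℕ → ℕ → List ℕ → Bool
isN k a w = avoids021 w ∧ (lar w ≡ᵇ k) ∧ (asc w ≡ᵇ a)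

avoids021⇒≥-before : ∀ p u M r Z s → contains021 (p ++ u ++ M ∷ r ++ Z ∷ s) ≡ false → Z < M →
                     All (Z ≤_) u
avoids021⇒≥-before p []      M r Z s h Z<M = []
avoids021⇒≥-before p (w ∷ u) M r Z s h Z<M with w <? Z
... | yes w<Z with trans (sym (contains021-witness p w u M r Z s w<Z Z<M)) h
...   | ()
avoids021⇒≥-before p (w ∷ u) M r Z s h Z<M | no w≮Z =
  ≮⇒≥ w≮Z ∷ avoids021⇒≥-before (p ++ [ w ]) u M r Z s (trans (cong contains021 (Listₚ.++-assoc p [ w ] _)) h) Z<M

sma-++-≥ : ∀ xs y ys → All (sma (y ∷ ys) ≤_) xs → sma (xs ++ y ∷ ys) ≡ sma (y ∷ ys)
sma-++-≥ []            y ys []       = refl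
sma-++-≥ (x ∷ [])      y ys (h ∷ []) = m≥n⇒m⊓n≡n h
sma-++-≥ (x ∷ x′ ∷ xs) y ys (h ∷ hs) rewrite sma-++-≥ (x′ ∷ xs) y ys hs = m≥n⇒m⊓n≡n h

length<Rsma : ∀ xs y ys → All (sma (y ∷ ys) ≤_) xs → length xs < Rsma (xs ++ y ∷ ys)
length<Rsma xs y ys h = subst (λ v → length xs < lastPos v (xs ++ y ∷ ys)) (sym (sma-++-≥ xs y ys h))
  (lastPos-++-occurs (sma (y ∷ ys)) xs (y ∷ ys) (occurs-sma y ys))

-- If entries follow the last maximum M, the last minimum lies among them: avoiding 021,
-- everything before M is at least the largest entry L after M.
max-not-last⇒Rlar<Rsma : ∀ u M z t → contains021 (u ++ M ∷ z ∷ t) ≡ false → All (_< M) (z ∷ t) →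
                          length (u ++ [ M ]) < Rsma ((u ++ [ M ]) ++ z ∷ t)
max-not-last⇒Rlar<Rsma u M z t no021 t<M = length<Rsma (u ++ [ M ]) z t (Allₚ.++⁺ u≥S (S<M ∷ []))
  where
  L = lar (z ∷ t)
  S = sma (z ∷ t)
  L<M : L < M
  L<M = All-occurs (z ∷ t) t<M (occurs-lar z t)
  S<M : S ≤ M
  S<M = <⇒≤ (≤-<-trans (sma≤lar z t) L<M)
  u≥S : All (S ≤_) u
  u≥S with splitAtLast L (z ∷ t) (occurs-lar z t)
  ... | r , s , t≡ , _ = All.map (≤-trans (sma≤lar z t))
          (avoids021⇒≥-before [] u M r L s (subst (λ t′ → contains021 (u ++ M ∷ t′) ≡ false) t≡ no021) L<M)

tail-empty : ∀ (u : List ℕ) M t → suc (length u) ≡ length (u ++ M ∷ t) → t ≡ []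
tail-empty u M []      h = refl
tail-empty u M (z ∷ t) h = ⊥-elim (m≢1+m+n (length u) (suc-injective (begin
  suc (length u)                ≡⟨ h ⟩
  length (u ++ M ∷ z ∷ t)       ≡⟨ Listₚ.length-++ u ⟩
  length u + suc (suc (length t)) ≡⟨ +-suc (length u) _ ⟩
  suc (length u + suc (length t)) ≡⟨ cong suc (+-suc (length u) _) ⟩
  suc (suc (length u + length t)) ∎)))
  where open ≡-Reasoning

Rlar≡length⇒ends-with-lar : ∀ x xs → Rlar (x ∷ xs) ≡ length (x ∷ xs) →
                            Σ[ u ∈ List ℕ ] x ∷ xs ≡ u ++ [ lar (x ∷ xs) ]
Rlar≡length⇒ends-with-lar x xs h with splitAtLast (lar (x ∷ xs)) (x ∷ xs) (occurs-lar x xs)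
... | u , t , e≡ , _ , pos =
  u , subst (λ t′ → x ∷ xs ≡ u ++ lar (x ∷ xs) ∷ t′) (tail-empty u _ t (trans (sym pos) (trans h (cong length e≡)))) e≡

SL⇒Rlar≡length : ∀ x xs → contains021 (x ∷ xs) ≡ false → Rsma (x ∷ xs) ≤ Rlar (x ∷ xs) →
                 Rlar (x ∷ xs) ≡ length (x ∷ xs)
SL⇒Rlar≡length x xs no021 Rsma≤Rlar with splitAtLast (lar (x ∷ xs)) (x ∷ xs) (occurs-lar x xs)
... | u , []    , e≡ , _ , pos = trans pos (sym (trans (cong length e≡) (trans (Listₚ.length-++ u) (+-comm (length u) 1))))
... | u , z ∷ t , e≡ , M∉t , pos = ⊥-elim (<⇒≱ Rlar<Rsma Rsma≤Rlar)
  where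
  M = lar (x ∷ xs)
  e≡′ : x ∷ xs ≡ (u ++ [ M ]) ++ z ∷ t
  e≡′ = trans e≡ (sym (Listₚ.++-assoc u [ M ] (z ∷ t)))
  t<M : All (_< M) (z ∷ t)
  t<M = ¬occurs⇒All< (z ∷ t) M∉t (All.tail (Allₚ.++⁻ʳ u (subst (All (_≤ M)) e≡ (All≤lar (x ∷ xs)))))
  Rlar<Rsma : Rlar (x ∷ xs) < Rsma (x ∷ xs)
  Rlar<Rsma = subst₂ _<_ (trans (Listₚ.length-++ u) (trans (+-comm (length u) 1) (sym pos))) (cong Rsma (sym e≡′))
    (max-not-last⇒Rlar<Rsma u M z t (trans (cong contains021 (sym e≡)) no021) t<M)

isHead : ℕ → ℕ → ℕ → ℕ → List ℕ → Bool
isHead k a k₁ a₁ x = all (k₁ ≤ᵇ_) x ∧ isSL k (a ∸ a₁) x ∧ (k₁ <ᵇ k)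

-- asc y ≤ a guards the truncated a ∸ asc y; lar y ≤ k, implied by lar y < k, bounds the
-- range of the sum in isCut-as-sum.
isCut : ℕ → ℕ → List ℕ → List ℕ → Bool
isCut k a x y = (lar y ≤ᵇ k) ∧ (asc y ≤ᵇ a) ∧ avoids021 y ∧ isHead k a (lar y) (asc y) x

all-≤ᵇ⇒All : ∀ k x → all (k ≤ᵇ_) x ≡ true → All (k ≤_) x
all-≤ᵇ⇒All k x h = All.map (≤ᵇ⇒≤ k _) (Allₚ.all⁺ (k ≤ᵇ_) x (≡true⇒T h))

All⇒all-≤ᵇ : ∀ k x → All (k ≤_) x → all (k ≤ᵇ_) x ≡ true
All⇒all-≤ᵇ k x h = T⇒≡true (Allₚ.all⁻ (k ≤ᵇ_) (All.map ≤⇒≤ᵇ h))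

lar-++-below : ∀ x y → lar y < lar x → lar (x ++ y) ≡ lar x
lar-++-below x y L<M = trans (lar-++ x y) (m≥n⇒m⊔n≡m (<⇒≤ L<M))

Rlar-++-below : ∀ x y → lar y < lar x → Rlar (x ++ y) ≡ Rlar x
Rlar-++-below x y L<M = trans (cong (λ v → lastPos v (x ++ y)) (lar-++-below x y L<M))
  (lastPos-++-¬occurs (lar x) x y (All<⇒¬occurs y (All.map (λ h → ≤-<-trans h L<M) (All≤lar y))))

Rlar≡length⇒lar< : ∀ x y ys → Rlar (x ++ y ∷ ys) ≡ length x → lar (y ∷ ys) < lar x
Rlar≡length⇒lar< x y ys h with lar (y ∷ ys) <? lar x
... | yes L<M = L<M
... | no  L≮M = ⊥-elim (<-irrefl (sym h) (subst (λ v → length x < lastPos v (x ++ y ∷ ys)) (sym lar≡L)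
                  (lastPos-++-occurs (lar (y ∷ ys)) x (y ∷ ys) (occurs-lar y ys))))
  where
  lar≡L : lar (x ++ y ∷ ys) ≡ lar (y ∷ ys)
  lar≡L = trans (lar-++ x (y ∷ ys)) (m≤n⇒m⊔n≡n (≮⇒≥ L≮M))

cut-LS⇒isCut : ∀ k a x xs y ys → let e = (x ∷ xs) ++ (y ∷ ys) in
               (isLS k a e ∧ (Rlar e ≡ᵇ length (x ∷ xs))) ≡ true → isCut k a (x ∷ xs) (y ∷ ys) ≡ true
cut-LS⇒isCut k a x xs y ys h =
  ∧-true-intro (≤⇒≤ᵇ-true (<⇒≤ L<k)) (∧-true-intro (≤⇒≤ᵇ-true ascʸ≤a) (∧-true-intro (not-true-intro y∌021)
    (∧-true-intro (All⇒all-≤ᵇ L X X≥L) (∧-true-intro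
      (∧-true-intro (not-true-intro x∌021)
        (∧-true-intro (≤⇒≤ᵇ-true (≤-trans (lastPos≤length _ X) (≤-reflexive (sym Rlarˣ))))
        (∧-true-intro (≡⇒≡ᵇ-true M≡k) (≡⇒≡ᵇ-true ascˣ))))
      (<⇒<ᵇ-true L<k)))))
  where
  X = x ∷ xs
  Y = y ∷ ys
  M = lar X
  L = lar Y
  h₁ = ∧-true-elim (isLS k a (X ++ Y)) h
  h₂ = ∧-true-elim (avoids021 (X ++ Y)) (proj₁ h₁)
  h₃ = ∧-true-elim (lar (X ++ Y) ≡ᵇ k) (proj₂ (∧-true-elim (Rlar (X ++ Y) <ᵇ Rsma (X ++ Y)) (proj₂ h₂)))
  L<M : L < M
  L<M = Rlar≡length⇒lar< X y ys (≡ᵇ-true⇒≡ (proj₂ h₁))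
  Rlarˣ : Rlar X ≡ length X
  Rlarˣ = trans (sym (Rlar-++-below X Y L<M)) (≡ᵇ-true⇒≡ (proj₂ h₁))
  X≥L : All (L ≤_) X
  X≥L with Rlar≡length⇒ends-with-lar x xs Rlarˣ | splitAtLast L Y (occurs-lar y ys)
  ... | u , X≡ | r , s , Y≡ , _ =
    subst (All (L ≤_)) (sym X≡) (Allₚ.++⁺ (avoids021⇒≥-before [] u M r L s no021 L<M) (<⇒≤ L<M ∷ []))
    where
    no021 : contains021 (u ++ M ∷ r ++ L ∷ s) ≡ false
    no021 = trans (cong contains021 (sym (trans (cong₂ _++_ X≡ Y≡) (Listₚ.++-assoc u [ M ] _))))
                  (not-true-elim (proj₁ h₂))
  contains021-parts = ∨-false-elim (contains021 X) (trans (sym (contains021-++ X Y X≥L)) (not-true-elim (proj₁ h₂)))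
  x∌021 = proj₁ contains021-parts
  y∌021 = proj₂ contains021-parts
  asc≡ : asc X + asc Y ≡ a
  asc≡ = trans (sym (asc-++ X Y X≥L)) (≡ᵇ-true⇒≡ (proj₂ h₃))
  ascʸ≤a : asc Y ≤ a
  ascʸ≤a = subst (asc Y ≤_) asc≡ (m≤n+m (asc Y) (asc X))
  ascˣ : asc X ≡ a ∸ asc Y
  ascˣ = trans (sym (m+n∸n≡m (asc X) (asc Y))) (cong (_∸ asc Y) asc≡)
  M≡k : M ≡ k
  M≡k = trans (sym (lar-++-below X Y L<M)) (≡ᵇ-true⇒≡ (proj₁ h₃))
  L<k : L < k
  L<k = subst (L <_) M≡k L<M

isCut⇒cut-LS : ∀ k a x xs y ys → let e = (x ∷ xs) ++ (y ∷ ys) in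
               isCut k a (x ∷ xs) (y ∷ ys) ≡ true → (isLS k a e ∧ (Rlar e ≡ᵇ length (x ∷ xs))) ≡ true
isCut⇒cut-LS k a x xs y ys h =
  ∧-true-intro (∧-true-intro (not-true-intro no021) (∧-true-intro (<⇒<ᵇ-true Rlar<Rsma)
    (∧-true-intro (≡⇒≡ᵇ-true lar≡k) (≡⇒≡ᵇ-true asc≡a)))) (≡⇒≡ᵇ-true Rlar≡)
  where
  X = x ∷ xs
  Y = y ∷ ys
  L = lar Y
  h₁ = ∧-true-elim (L ≤ᵇ k) h
  h₂ = ∧-true-elim (asc Y ≤ᵇ a) (proj₂ h₁)
  h₃ = ∧-true-elim (avoids021 Y) (proj₂ h₂)
  h₄ = ∧-true-elim (all (L ≤ᵇ_) X) (proj₂ h₃)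
  h₅ = ∧-true-elim (isSL k (a ∸ asc Y) X) (proj₂ h₄)
  h₆ = ∧-true-elim (avoids021 X) (proj₁ h₅)
  h₇ = ∧-true-elim (Rsma X ≤ᵇ Rlar X) (proj₂ h₆)
  h₈ = ∧-true-elim (lar X ≡ᵇ k) (proj₂ h₇)
  X≥L : All (L ≤_) X
  X≥L = all-≤ᵇ⇒All L X (proj₁ h₄)
  M≡k : lar X ≡ k
  M≡k = ≡ᵇ-true⇒≡ (proj₁ h₈)
  L<M : L < lar X
  L<M = subst (L <_) (sym M≡k) (<ᵇ-true⇒< (proj₂ h₅))
  Rlar≡ : Rlar (X ++ Y) ≡ length X
  Rlar≡ = trans (Rlar-++-below X Y L<M)
                (SL⇒Rlar≡length x xs (not-true-elim (proj₁ h₆)) (≤ᵇ-true⇒≤ (proj₁ h₇)))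
  no021 : contains021 (X ++ Y) ≡ false
  no021 = trans (contains021-++ X Y X≥L) (cong₂ _∨_ (not-true-elim (proj₁ h₆)) (not-true-elim (proj₁ h₃)))
  lar≡k : lar (X ++ Y) ≡ k
  lar≡k = trans (lar-++-below X Y L<M) M≡k
  asc≡a : asc (X ++ Y) ≡ a
  asc≡a = trans (asc-++ X Y X≥L)
                (trans (cong (_+ asc Y) (≡ᵇ-true⇒≡ (proj₂ h₈))) (m∸n+n≡m {a} {asc Y} (≤ᵇ-true⇒≤ (proj₁ h₂))))
  Rlar<Rsma : Rlar (X ++ Y) < Rsma (X ++ Y)
  Rlar<Rsma = subst (_< Rsma (X ++ Y)) (sym Rlar≡)
                (length<Rsma X y ys (All.map (≤-trans (sma≤lar y ys)) X≥L))

cut-LS≡isCut : ∀ k a x xs y ys → let e = (x ∷ xs) ++ (y ∷ ys) in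
               (isLS k a e ∧ (Rlar e ≡ᵇ length (x ∷ xs))) ≡ isCut k a (x ∷ xs) (y ∷ ys)
cut-LS≡isCut k a x xs y ys = Bool-ext (cut-LS⇒isCut k a x xs y ys) (isCut⇒cut-LS k a x xs y ys)

𝟙 : Bool → ℕ
𝟙 b = if b then 1 else 0

sumBy : ∀ {A : Set} → (A → ℕ) → List A → ℕ
sumBy f []       = 0
sumBy f (x ∷ xs) = f x + sumBy f xs

infix 5 sumBy
syntax sumBy (λ x → e) xs = ∑[ x ∈ xs ] e

∑< : ℕ → (ℕ → ℕ) → ℕ
∑< zero    g = 0
∑< (suc n) g = ∑< n g + g n

infix 5 ∑<
syntax ∑< n (λ i → e) = ∑[ i < n ] e

𝟙-∧ : ∀ b c → 𝟙 (b ∧ c) ≡ 𝟙 b * 𝟙 c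
𝟙-∧ true  c = sym (+-identityʳ (𝟙 c))
𝟙-∧ false c = refl

count≡sumBy : ∀ (P : List ℕ → Bool) xs → count P xs ≡ ∑[ x ∈ xs ] 𝟙 (P x)
count≡sumBy P []       = refl
count≡sumBy P (x ∷ xs) with P x
... | true  = cong suc (count≡sumBy P xs)
... | false = count≡sumBy P xs

sumBy-cong : ∀ {A : Set} {f g : A → ℕ} xs → (∀ x → f x ≡ g x) → sumBy f xs ≡ sumBy g xs
sumBy-cong []       h = refl
sumBy-cong (x ∷ xs) h = cong₂ _+_ (h x) (sumBy-cong xs h)

sumBy-congᴬ : ∀ {A : Set} {P : A → Set} {f g : A → ℕ} {xs} → All P xs → (∀ x → P x → f x ≡ g x) →
              sumBy f xs ≡ sumBy g xs
sumBy-congᴬ []         h = refl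
sumBy-congᴬ (px ∷ pxs) h = cong₂ _+_ (h _ px) (sumBy-congᴬ pxs h)

sumBy-zero : ∀ {A : Set} {f : A → ℕ} xs → (∀ x → f x ≡ 0) → sumBy f xs ≡ 0
sumBy-zero []       h = refl
sumBy-zero (x ∷ xs) h rewrite h x = sumBy-zero xs h

sumBy-zeroᴬ : ∀ {A : Set} {P : A → Set} {f : A → ℕ} {xs} → All P xs → (∀ x → P x → f x ≡ 0) →
              sumBy f xs ≡ 0
sumBy-zeroᴬ {xs = xs} pxs h = trans (sumBy-congᴬ pxs h) (sumBy-zero xs (λ _ → refl))

sumBy-++ : ∀ {A : Set} (f : A → ℕ) xs ys → sumBy f (xs ++ ys) ≡ sumBy f xs + sumBy f ys
sumBy-++ f []       ys = refl
sumBy-++ f (x ∷ xs) ys rewrite sumBy-++ f xs ys = sym (+-assoc (f x) _ _)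

sumBy-map : ∀ {A B : Set} (F : B → ℕ) (f : A → B) xs → sumBy F (map f xs) ≡ ∑[ x ∈ xs ] F (f x)
sumBy-map F f []       = refl
sumBy-map F f (x ∷ xs) = cong (F (f x) +_) (sumBy-map F f xs)

sumBy-concatMap : ∀ {A B : Set} (F : B → ℕ) (f : A → List B) xs → sumBy F (concatMap f xs) ≡ ∑[ x ∈ xs ] sumBy F (f x)
sumBy-concatMap F f []       = refl
sumBy-concatMap F f (x ∷ xs) =
  trans (sumBy-++ F (f x) (concatMap f xs)) (cong (sumBy F (f x) +_) (sumBy-concatMap F f xs))

*-sumBy : ∀ {A : Set} c (f : A → ℕ) xs → c * sumBy f xs ≡ ∑[ x ∈ xs ] c * f x
*-sumBy c f []       = *-zeroʳ c
*-sumBy c f (x ∷ xs) = trans (*-distribˡ-+ c (f x) _) (cong (c * f x +_) (*-sumBy c f xs))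

sumBy-product : ∀ {A B : Set} (f : A → ℕ) (g : B → ℕ) xs ys →
                ∑[ x ∈ xs ] ∑[ y ∈ ys ] g y * f x ≡ sumBy g ys * sumBy f xs
sumBy-product f g xs ys = trans (sumBy-cong xs inner) (sym (*-sumBy (sumBy g ys) f xs))
  where
  inner : ∀ x → ∑[ y ∈ ys ] g y * f x ≡ sumBy g ys * f x
  inner x = trans (sumBy-cong ys (λ y → *-comm (g y) (f x))) (trans (sym (*-sumBy (f x) g ys)) (*-comm (f x) (sumBy g ys)))

sumBy-upTo : ∀ n (g : ℕ → ℕ) → sumBy g (upTo n) ≡ ∑< n g
sumBy-upTo zero    g = refl
sumBy-upTo (suc n) g = trans (cong (sumBy g) (sym (Listₚ.upTo-∷ʳ n)))
  (trans (sumBy-++ g (upTo n) [ n ]) (cong₂ _+_ (sumBy-upTo n g) (+-identityʳ (g n))))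

∑<-cong : ∀ n {f g : ℕ → ℕ} → (∀ i → i < n → f i ≡ g i) → ∑< n f ≡ ∑< n g
∑<-cong zero    h = refl
∑<-cong (suc n) h = cong₂ _+_ (∑<-cong n (λ i i<n → h i (m<n⇒m<1+n i<n))) (h n ≤-refl)

∑<-zero : ∀ n {f : ℕ → ℕ} → (∀ i → i < n → f i ≡ 0) → ∑< n f ≡ 0
∑<-zero zero    h = refl
∑<-zero (suc n) h rewrite ∑<-zero n (λ i i<n → h i (m<n⇒m<1+n i<n)) | h n ≤-refl = refl

∑<-single : ∀ n {f : ℕ → ℕ} j → j < n → (∀ i → i < n → i ≢ j → f i ≡ 0) → ∑< n f ≡ f j
∑<-single (suc n) {f} j j<1+n h with j ≟ n
... | yes refl = cong (_+ f j) (∑<-zero j (λ i i<j → h i (m<n⇒m<1+n i<j) (<⇒≢ i<j)))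
... | no  j≢n  = trans (cong₂ _+_ (∑<-single n j (≤∧≢⇒< (s≤s⁻¹ j<1+n) j≢n) (λ i i<n → h i (m<n⇒m<1+n i<n)))
                                  (h n ≤-refl (j≢n ∘ sym)))
                       (+-identityʳ (f j))

∑<-≤-single : ∀ n v (f : ℕ → ℕ) → (∀ i → i ≢ v → f i ≡ 0) → ∑[ i < suc n ] f i ≡ 𝟙 (v ≤ᵇ n) * f v
∑<-≤-single n v f h with v ≤? n
... | yes v≤n rewrite ≤⇒≤ᵇ-true v≤n = trans (∑<-single (suc n) v (s≤s v≤n) (λ i _ → h i)) (sym (+-identityʳ (f v)))
... | no  v≰n rewrite ≰⇒≤ᵇ-false v≰n = ∑<-zero (suc n) (λ i i≤n → h i (λ { refl → v≰n (s≤s⁻¹ i≤n) }))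

∑<-head : ∀ n (f : ℕ → ℕ) → (∀ i → f (suc i) ≡ 0) → ∑[ i < suc n ] f i ≡ f 0
∑<-head zero    f h = refl
∑<-head (suc n) f h rewrite h n = trans (+-identityʳ _) (∑<-head n f h)

∑<-+ : ∀ n (f g : ℕ → ℕ) → ∑[ i < n ] (f i + g i) ≡ ∑< n f + ∑< n g
∑<-+ zero    f g = refl
∑<-+ (suc n) f g rewrite ∑<-+ n f g = interchange (∑< n f) (∑< n g) (f n) (g n)
  where open import Algebra.Properties.CommutativeSemigroup +-commutativeSemigroup using (interchange)

∑<-comm : ∀ m n (f : ℕ → ℕ → ℕ) → ∑[ i < m ] ∑[ j < n ] f i j ≡ ∑[ j < n ] ∑[ i < m ] f i j
∑<-comm zero    n f = sym (∑<-zero n (λ _ _ → refl))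
∑<-comm (suc m) n f rewrite ∑<-comm m n f = sym (∑<-+ n (λ j → ∑[ i < m ] f i j) (λ j → f m j))

sumBy-∑< : ∀ {A : Set} n (f : A → ℕ → ℕ) xs → ∑[ x ∈ xs ] ∑[ i < n ] f x i ≡ ∑[ i < n ] ∑[ x ∈ xs ] f x i
sumBy-∑< n f []       = sym (∑<-zero n (λ _ _ → refl))
sumBy-∑< n f (x ∷ xs) rewrite sumBy-∑< n f xs = sym (∑<-+ n (f x) (λ i → ∑[ x ∈ xs ] f x i))

sumBy-∑<₂ : ∀ {A : Set} m n (f : A → ℕ → ℕ → ℕ) xs →
  ∑[ x ∈ xs ] ∑[ i < m ] ∑[ j < n ] f x i j ≡ ∑[ i < m ] ∑[ j < n ] ∑[ x ∈ xs ] f x i j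
sumBy-∑<₂ m n f xs = trans (sumBy-∑< m _ xs) (∑<-cong m (λ i _ → sumBy-∑< n (λ x j → f x i j) xs))

*-∑< : ∀ n c (f : ℕ → ℕ) → c * ∑< n f ≡ ∑[ i < n ] c * f i
*-∑< zero    c f = *-zeroʳ c
*-∑< (suc n) c f rewrite sym (*-∑< n c f) = *-distribˡ-+ c (∑< n f) (f n)

∑<-below : ∀ b c (g : ℕ → ℕ) → ∑[ x < b ] (if x <ᵇ c then g x else 0) ≡ ∑< (b ⊓ c) g
∑<-below zero    c g = refl
∑<-below (suc b) c g with b <ᵇ c in eq
... | true  = trans (cong (_+ g b) (∑<-below b c g))
                (trans (cong (λ m → ∑< m g + g b) (m≤n⇒m⊓n≡m (<⇒≤ b<c)))
                       (cong (λ m → ∑< m g) (sym (m≤n⇒m⊓n≡m b<c))))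
  where
  b<c : b < c
  b<c = <ᵇ-true⇒< eq
... | false = trans (+-identityʳ _) (trans (∑<-below b c g)
                (cong (λ m → ∑< m g) (trans (m≥n⇒m⊓n≡n c≤b) (sym (m≥n⇒m⊓n≡n (m≤n⇒m≤1+n c≤b))))))
  where
  c≤b : c ≤ b
  c≤b = ≮⇒≥ (λ b<c → subst T eq (<⇒<ᵇ b<c))

∑<-above : ∀ b k (g : ℕ → ℕ) → ∑[ x < b ] (if k ≤ᵇ x then g x else 0) ≡ ∑[ i < b ∸ k ] g (k + i)
∑<-above zero    k g = cong (λ m → ∑[ i < m ] g (k + i)) (sym (0∸n≡0 k))
∑<-above (suc b) k g with k ≤ᵇ b in eq
... | true  = trans (cong (_+ g b) (∑<-above b k g))
                (trans (cong ((∑[ i < b ∸ k ] g (k + i)) +_) (cong g (sym (m+[n∸m]≡n k≤b))))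
                       (cong (λ m → ∑[ i < m ] g (k + i)) (sym (+-∸-assoc 1 k≤b))))
  where
  k≤b : k ≤ b
  k≤b = ≤ᵇ-true⇒≤ eq
... | false = trans (+-identityʳ _) (trans (∑<-above b k g)
                (cong (λ m → ∑[ i < m ] g (k + i)) (trans (m≤n⇒m∸n≡0 (<⇒≤ b<k)) (sym (m≤n⇒m∸n≡0 b<k)))))
  where
  b<k : b < k
  b<k = ≰⇒> (λ k≤b → subst T eq (≤⇒≤ᵇ k≤b))

isN-lar : ∀ {k₁} a₁ y → k₁ ≢ lar y → isN k₁ a₁ y ≡ false
isN-lar a₁ y k₁≢L rewrite ≢⇒≡ᵇ-false (k₁≢L ∘ sym) = Boolₚ.∧-zeroʳ (avoids021 y)

isN-asc : ∀ k₁ {a₁} y → a₁ ≢ asc y → isN k₁ a₁ y ≡ false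
isN-asc k₁ y a₁≢A rewrite ≢⇒≡ᵇ-false (a₁≢A ∘ sym) =
  trans (cong (avoids021 y ∧_) (Boolₚ.∧-zeroʳ (lar y ≡ᵇ k₁))) (Boolₚ.∧-zeroʳ (avoids021 y))

isCut-as-sum : ∀ k a x y →
  𝟙 (isCut k a x y) ≡ ∑[ k₁ < suc k ] ∑[ a₁ < suc a ] 𝟙 (isN k₁ a₁ y) * 𝟙 (isHead k a k₁ a₁ x)
isCut-as-sum k a x y = sym (begin
  ∑[ k₁ < suc k ] ∑[ a₁ < suc a ] term k₁ a₁
    ≡⟨ ∑<-cong (suc k) (λ k₁ _ → ∑<-≤-single a A (term k₁) (λ a₁ a₁≢A →
         cong (λ b → 𝟙 b * 𝟙 (isHead k a k₁ a₁ x)) (isN-asc k₁ y a₁≢A))) ⟩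
  ∑[ k₁ < suc k ] 𝟙 (A ≤ᵇ a) * term k₁ A
    ≡⟨ ∑<-≤-single k L _ (λ k₁ k₁≢L →
         trans (cong (λ b → 𝟙 (A ≤ᵇ a) * (𝟙 b * 𝟙 (isHead k a k₁ A x))) (isN-lar A y k₁≢L))
               (*-zeroʳ (𝟙 (A ≤ᵇ a)))) ⟩
  𝟙 (L ≤ᵇ k) * (𝟙 (A ≤ᵇ a) * (𝟙 (isN L A y) * 𝟙 (isHead k a L A x)))
    ≡⟨ cong (λ b → 𝟙 (L ≤ᵇ k) * (𝟙 (A ≤ᵇ a) * (𝟙 b * 𝟙 (isHead k a L A x)))) isN-self ⟩
  𝟙 (L ≤ᵇ k) * (𝟙 (A ≤ᵇ a) * (𝟙 (avoids021 y) * 𝟙 (isHead k a L A x)))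
    ≡⟨ trans (𝟙-∧ (L ≤ᵇ k) _) (cong (𝟙 (L ≤ᵇ k) *_)
         (trans (𝟙-∧ (A ≤ᵇ a) _) (cong (𝟙 (A ≤ᵇ a) *_) (𝟙-∧ (avoids021 y) _)))) ⟨
  𝟙 (isCut k a x y) ∎)
  where
  open ≡-Reasoning
  L = lar y
  A = asc y
  term : ℕ → ℕ → ℕ
  term k₁ a₁ = 𝟙 (isN k₁ a₁ y) * 𝟙 (isHead k a k₁ a₁ x)
  isN-self : isN L A y ≡ avoids021 y
  isN-self rewrite ≡ᵇ-refl L | ≡ᵇ-refl A = Boolₚ.∧-identityʳ (avoids021 y)

sumBy-box : ∀ b bs (F : List ℕ → ℕ) → sumBy F (box (b ∷ bs)) ≡ ∑[ x < b ] ∑[ z ∈ box bs ] F (x ∷ z)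
sumBy-box b bs F = trans (sumBy-concatMap F (λ x → map (x ∷_) (box bs)) (upTo b))
  (trans (sumBy-cong (upTo b) (λ x → sumBy-map F (x ∷_) (box bs))) (sumBy-upTo b _))

sumBy-box-++ : ∀ bs cs (F : List ℕ → ℕ) → sumBy F (box (bs ++ cs)) ≡ ∑[ x ∈ box bs ] ∑[ y ∈ box cs ] F (x ++ y)
sumBy-box-++ []       cs F = sym (+-identityʳ _)
sumBy-box-++ (b ∷ bs) cs F = trans (sumBy-box b (bs ++ cs) F)
  (trans (∑<-cong b (λ x _ → sumBy-box-++ bs cs (λ z → F (x ∷ z))))
         (sym (sumBy-box b bs (λ x → ∑[ y ∈ box cs ] F (x ++ y)))))

All-length-box : ∀ bs → All (λ x → length x ≡ length bs) (box bs)
All-length-box []       = refl ∷ []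
All-length-box (b ∷ bs) = All-concatMap (upTo b) (λ x → Allₚ.map⁺ (All.map (cong suc) (All-length-box bs)))
  where
  All-concatMap : ∀ {P : List ℕ → Set} {f : ℕ → List (List ℕ)} xs → (∀ x → All P (f x)) → All P (concatMap f xs)
  All-concatMap []       h = []
  All-concatMap (x ∷ xs) h = Allₚ.++⁺ (h x) (All-concatMap xs h)

sumBy-box-below : ∀ bs c (P : List ℕ → Bool) →
  ∑[ y ∈ box bs ] 𝟙 (all (_<ᵇ c) y ∧ P y) ≡ ∑[ y ∈ box (map (_⊓ c) bs) ] 𝟙 (P y)
sumBy-box-below []       c P = refl
sumBy-box-below (b ∷ bs) c P = trans (sumBy-box b bs _)
  (trans (∑<-cong b (λ x _ → step x))
  (trans (∑<-below b c _) (sym (sumBy-box (b ⊓ c) (map (_⊓ c) bs) _))))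
  where
  step : ∀ x → ∑[ z ∈ box bs ] 𝟙 (((x <ᵇ c) ∧ all (_<ᵇ c) z) ∧ P (x ∷ z))
             ≡ (if x <ᵇ c then ∑[ z ∈ box (map (_⊓ c) bs) ] 𝟙 (P (x ∷ z)) else 0)
  step x with x <ᵇ c
  ... | true  = sumBy-box-below bs c (λ z → P (x ∷ z))
  ... | false = sumBy-zero (box bs) (λ _ → refl)

sumBy-box-above : ∀ bs k (P : List ℕ → Bool) →
  ∑[ x ∈ box bs ] 𝟙 (all (k ≤ᵇ_) x ∧ P x) ≡ ∑[ x ∈ box (map (_∸ k) bs) ] 𝟙 (P (shift k x))
sumBy-box-above []       k P = refl
sumBy-box-above (b ∷ bs) k P = trans (sumBy-box b bs _)
  (trans (∑<-cong b (λ x _ → step x))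
  (trans (∑<-above b k _) (sym (sumBy-box (b ∸ k) (map (_∸ k) bs) _))))
  where
  step : ∀ x → ∑[ z ∈ box bs ] 𝟙 (((k ≤ᵇ x) ∧ all (k ≤ᵇ_) z) ∧ P (x ∷ z))
             ≡ (if k ≤ᵇ x then ∑[ z ∈ box (map (_∸ k) bs) ] 𝟙 (P (x ∷ shift k z)) else 0)
  step x with k ≤ᵇ x
  ... | true  = sumBy-box-above bs k (λ z → P (x ∷ z))
  ... | false = sumBy-zero (box bs) (λ _ → refl)

sumBy-box-empty : ∀ b bs (F : List ℕ → ℕ) → b ≡ 0 → sumBy F (box (b ∷ bs)) ≡ 0
sumBy-box-empty .0 bs F refl = refl

sumBy-box-ones : ∀ n (F : List ℕ → ℕ) → sumBy F (box (replicate n 1)) ≡ F (replicate n 0)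
sumBy-box-ones zero    F = +-identityʳ (F [])
sumBy-box-ones (suc n) F = trans (sumBy-box 1 (replicate n 1) F) (sumBy-box-ones n (λ z → F (0 ∷ z)))

countN : ℕ → ℕ → ℕ → ℕ
countN zero    k a = 0
countN (suc m) k a = count (isN k a) (Nk (suc m) k)

countSL⁺ : ℕ → ℕ → ℕ → ℕ → ℕ
countSL⁺ zero    p       k       a = 0
countSL⁺ (suc m) zero    k       a = 0
countSL⁺ (suc m) (suc q) zero    a = 0
countSL⁺ (suc m) (suc q) (suc k) a = count (isSL (suc k) a) (I (suc m) (suc q))

-- the part of the coefficient of 𝒩(x, us) · G*⁺ where 𝒩 contributes x^{n₁}; its u^{k₁} comes
-- with s^{k₁}, whence k₁ ≤ p
rhsTerm : ℕ → ℕ → ℕ → ℕ → ℕ → ℕ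
rhsTerm n p k a n₁ =
  ∑[ k₁ < suc k ] 𝟙 (k₁ ≤ᵇ p) * (∑[ a₁ < suc a ] countN n₁ k₁ a₁ * countSL⁺ (n ∸ n₁) (p ∸ k₁) (k ∸ k₁) (a ∸ a₁))

rhsCoef : ℕ → ℕ → ℕ → ℕ → ℕ
rhsCoef n p k a = ∑[ n₁ < suc n ] rhsTerm n p k a n₁

lar≤⇒all< : ∀ e {c} → lar e ≤ c → all (_<ᵇ suc c) e ≡ true
lar≤⇒all< e lar≤c =
  T⇒≡true (Allₚ.all⁻ _ (All.map (λ u≤lar → <⇒<ᵇ (s≤s (≤-trans u≤lar lar≤c))) (All≤lar e)))

isN-bounded : ∀ k₁ a₁ y → isN k₁ a₁ y ≡ all (_<ᵇ suc k₁) y ∧ isN k₁ a₁ y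
isN-bounded k₁ a₁ y = Bool-ext (λ h → ∧-true-intro (lar≤⇒all< y (≤-reflexive (lar≡ h))) h)
                               (λ h → proj₂ (∧-true-elim (all (_<ᵇ suc k₁) y) h))
  where
  lar≡ : isN k₁ a₁ y ≡ true → lar y ≡ k₁
  lar≡ h = ≡ᵇ-true⇒≡ (proj₁ (∧-true-elim (lar y ≡ᵇ k₁) (proj₂ (∧-true-elim (avoids021 y) h))))

isSL-bounded : ∀ k a e → isSL k a e ≡ all (_<ᵇ suc k) e ∧ isSL k a e
isSL-bounded k a e = Bool-ext (λ h → ∧-true-intro (lar≤⇒all< e (≤-reflexive (lar≡ h))) h)
                              (λ h → proj₂ (∧-true-elim (all (_<ᵇ suc k) e) h))
  where
  lar≡ : isSL k a e ≡ true → lar e ≡ k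
  lar≡ h = ≡ᵇ-true⇒≡ (proj₁ (∧-true-elim (lar e ≡ᵇ k)
             (proj₂ (∧-true-elim (Rsma e ≤ᵇ Rlar e) (proj₂ (∧-true-elim (avoids021 e) h))))))

map-⊓-≥ : ∀ c bs → All (c ≤_) bs → map (_⊓ c) bs ≡ replicate (length bs) c
map-⊓-≥ c []       []         = refl
map-⊓-≥ c (b ∷ bs) (c≤b ∷ hs) = cong₂ _∷_ (m≥n⇒m⊓n≡n c≤b) (map-⊓-≥ c bs hs)

sumBy-box-isN : ∀ k₁ a₁ b bs → All (k₁ <_) (b ∷ bs) →
  ∑[ y ∈ box (b ∷ bs) ] 𝟙 (isN k₁ a₁ y) ≡ countN (length (b ∷ bs)) k₁ a₁
sumBy-box-isN k₁ a₁ b bs k₁< = begin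
  ∑[ y ∈ box (b ∷ bs) ] 𝟙 (isN k₁ a₁ y)
    ≡⟨ sumBy-cong (box (b ∷ bs)) (λ y → cong 𝟙 (isN-bounded k₁ a₁ y)) ⟩
  ∑[ y ∈ box (b ∷ bs) ] 𝟙 (all (_<ᵇ suc k₁) y ∧ isN k₁ a₁ y)
    ≡⟨ sumBy-box-below (b ∷ bs) (suc k₁) (isN k₁ a₁) ⟩
  ∑[ y ∈ box (map (_⊓ suc k₁) (b ∷ bs)) ] 𝟙 (isN k₁ a₁ y)
    ≡⟨ cong (λ B → ∑[ y ∈ box B ] 𝟙 (isN k₁ a₁ y)) (map-⊓-≥ (suc k₁) (b ∷ bs) k₁<) ⟩
  ∑[ y ∈ Nk (length (b ∷ bs)) k₁ ] 𝟙 (isN k₁ a₁ y)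
    ≡⟨ sym (count≡sumBy (isN k₁ a₁) (Nk (length (b ∷ bs)) k₁)) ⟩
  countN (length (b ∷ bs)) k₁ a₁ ∎
  where open ≡-Reasoning

isSL-shift : ∀ k₁ k A x xs → k₁ ≤ k → isSL k A (shift k₁ (x ∷ xs)) ≡ isSL (k ∸ k₁) A (x ∷ xs)
isSL-shift k₁ k A x xs k₁≤k
  rewrite contains021-shift k₁ (x ∷ xs) | sma-shift k₁ x xs | lar-shift k₁ x xs
  | lastPos-shift k₁ (sma (x ∷ xs)) (x ∷ xs) | lastPos-shift k₁ (lar (x ∷ xs)) (x ∷ xs)
  | asc-shift k₁ (x ∷ xs) =
  cong (λ b → avoids021 (x ∷ xs) ∧ (Rsma (x ∷ xs) ≤ᵇ Rlar (x ∷ xs)) ∧ b ∧ (asc (x ∷ xs) ≡ᵇ A)) lar≡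
  where
  lar≡ : (k₁ + lar (x ∷ xs) ≡ᵇ k) ≡ (lar (x ∷ xs) ≡ᵇ k ∸ k₁)
  lar≡ = trans (cong (k₁ + lar (x ∷ xs) ≡ᵇ_) (sym (m+[n∸m]≡n k₁≤k))) (≡ᵇ-+ˡ k₁ (lar (x ∷ xs)) (k ∸ k₁))

countSL⁺≡sumBy : ∀ j q K A → 0 < K → countSL⁺ (suc j) (suc q) K A ≡ ∑[ σ ∈ I (suc j) (suc q) ] 𝟙 (isSL K A σ)
countSL⁺≡sumBy j q (suc K) A _ = count≡sumBy (isSL (suc K) A) (I (suc j) (suc q))

sumBy-I-isSL-shift : ∀ j p k₁ k A →
  ∑[ σ ∈ I (suc j) p ] 𝟙 (isSL k A (shift k₁ σ) ∧ (k₁ <ᵇ k)) ≡ countSL⁺ (suc j) p (k ∸ k₁) A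
sumBy-I-isSL-shift j zero    k₁ k A = refl
sumBy-I-isSL-shift j (suc q) k₁ k A with k₁ <? k
... | yes k₁<k rewrite <⇒<ᵇ-true k₁<k =
  trans (sumBy-congᴬ (All-length-box (Ibounds (suc j) (suc q))) term)
        (sym (countSL⁺≡sumBy j q (k ∸ k₁) A (m<n⇒0<n∸m k₁<k)))
  where
  term : ∀ σ → length σ ≡ length (Ibounds (suc j) (suc q)) →
         𝟙 (isSL k A (shift k₁ σ) ∧ true) ≡ 𝟙 (isSL (k ∸ k₁) A σ)
  term (x ∷ xs) _ = cong 𝟙 (trans (Boolₚ.∧-identityʳ _) (isSL-shift k₁ k A x xs (<⇒≤ k₁<k)))
... | no k₁≮k rewrite m≤n⇒m∸n≡0 (≮⇒≥ k₁≮k) | ≥⇒<ᵇ-false (≮⇒≥ k₁≮k) =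
  sumBy-zero (I (suc j) (suc q)) (λ σ → cong 𝟙 (Boolₚ.∧-zeroʳ (isSL k A (shift k₁ σ))))

length-Ibounds : ∀ m p → length (Ibounds (suc m) p) ≡ suc m
length-Ibounds m p = cong suc (trans (Listₚ.length-map _ (upTo m)) (Listₚ.length-upTo m))

Ibounds-∸ : ∀ n p k₁ → k₁ ≤ p → map (_∸ k₁) (Ibounds n p) ≡ Ibounds n (p ∸ k₁)
Ibounds-∸ n p k₁ k₁≤p = cong ((p ∸ k₁) ∷_) (trans (sym (Listₚ.map-∘ (upTo (n ∸ 1))))
  (Listₚ.map-cong (λ i → +-∸-comm (suc (suc i)) k₁≤p) (upTo (n ∸ 1))))

sumBy-I-isHead : ∀ j p k a k₁ a₁ →
  ∑[ x ∈ I (suc j) p ] 𝟙 (isHead k a k₁ a₁ x) ≡ 𝟙 (k₁ ≤ᵇ p) * countSL⁺ (suc j) (p ∸ k₁) (k ∸ k₁) (a ∸ a₁)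
sumBy-I-isHead j p k a k₁ a₁ with k₁ ≤? p
... | yes k₁≤p rewrite ≤⇒≤ᵇ-true k₁≤p = begin
  ∑[ x ∈ I (suc j) p ] 𝟙 (isHead k a k₁ a₁ x)
    ≡⟨ sumBy-box-above (Ibounds (suc j) p) k₁ (λ x → isSL k (a ∸ a₁) x ∧ (k₁ <ᵇ k)) ⟩
  ∑[ σ ∈ box (map (_∸ k₁) (Ibounds (suc j) p)) ] 𝟙 (isSL k (a ∸ a₁) (shift k₁ σ) ∧ (k₁ <ᵇ k))
    ≡⟨ cong (λ B → ∑[ σ ∈ box B ] 𝟙 (isSL k (a ∸ a₁) (shift k₁ σ) ∧ (k₁ <ᵇ k)))
            (Ibounds-∸ (suc j) p k₁ k₁≤p) ⟩
  ∑[ σ ∈ I (suc j) (p ∸ k₁) ] 𝟙 (isSL k (a ∸ a₁) (shift k₁ σ) ∧ (k₁ <ᵇ k))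
    ≡⟨ sumBy-I-isSL-shift j (p ∸ k₁) k₁ k (a ∸ a₁) ⟩
  countSL⁺ (suc j) (p ∸ k₁) (k ∸ k₁) (a ∸ a₁)
    ≡⟨ sym (+-identityʳ _) ⟩
  1 * countSL⁺ (suc j) (p ∸ k₁) (k ∸ k₁) (a ∸ a₁) ∎
  where open ≡-Reasoning
... | no k₁≰p rewrite ≰⇒≤ᵇ-false k₁≰p =
  trans (sumBy-box-above (Ibounds (suc j) p) k₁ (λ x → isSL k (a ∸ a₁) x ∧ (k₁ <ᵇ k)))
        (sumBy-box-empty (p ∸ k₁) (map (_∸ k₁) (map (λ i → p + suc (suc i)) (upTo j))) _
                         (m≤n⇒m∸n≡0 (<⇒≤ (≰⇒> k₁≰p))))

applyUpTo-+ : ∀ {A : Set} (f : ℕ → A) m n → applyUpTo f (m + n) ≡ applyUpTo f m ++ applyUpTo (f ∘ (m +_)) n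
applyUpTo-+ f zero    n = refl
applyUpTo-+ f (suc m) n = cong (f 0 ∷_) (applyUpTo-+ (f ∘ suc) m n)

Itail : ℕ → ℕ → ℕ → List ℕ
Itail j n₁ p = applyUpTo (λ i → p + suc (suc (j + i))) n₁

Ibounds-split : ∀ j n₁ p → Ibounds (suc (j + n₁)) p ≡ Ibounds (suc j) p ++ Itail j n₁ p
Ibounds-split j n₁ p = cong (p ∷_) (trans (Listₚ.map-upTo g (j + n₁))
  (trans (applyUpTo-+ g j n₁) (cong (_++ Itail j n₁ p) (sym (Listₚ.map-upTo g j)))))
  where
  g : ℕ → ℕ
  g i = p + suc (suc i)

sumBy-Itail-isN : ∀ j n₁ p k₁ a₁ → k₁ ≤ p →
                  ∑[ y ∈ box (Itail j (suc n₁) p) ] 𝟙 (isN k₁ a₁ y) ≡ countN (suc n₁) k₁ a₁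
sumBy-Itail-isN j n₁ p k₁ a₁ k₁≤p =
  trans (sumBy-box-isN k₁ a₁ _ _
           (Allₚ.applyUpTo⁺₂ _ (suc n₁) (λ i → ≤-<-trans k₁≤p (m<m+n p {suc (suc (j + i))} z<s))))
        (cong (λ n → countN (suc n) k₁ a₁) (Listₚ.length-applyUpTo _ n₁))

sumBy-cut-parts : ∀ j n₁ p k a k₁ a₁ →
  (∑[ y ∈ box (Itail j (suc n₁) p) ] 𝟙 (isN k₁ a₁ y)) * (∑[ x ∈ I (suc j) p ] 𝟙 (isHead k a k₁ a₁ x))
    ≡ 𝟙 (k₁ ≤ᵇ p) * (countN (suc n₁) k₁ a₁ * countSL⁺ (suc j) (p ∸ k₁) (k ∸ k₁) (a ∸ a₁))
sumBy-cut-parts j n₁ p k a k₁ a₁ rewrite sumBy-I-isHead j p k a k₁ a₁ with k₁ ≤? p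
... | no  k₁≰p rewrite ≰⇒≤ᵇ-false k₁≰p = *-zeroʳ (∑[ y ∈ box (Itail j (suc n₁) p) ] 𝟙 (isN k₁ a₁ y))
... | yes k₁≤p rewrite ≤⇒≤ᵇ-true k₁≤p | sumBy-Itail-isN j n₁ p k₁ a₁ k₁≤p =
  trans (cong (countN (suc n₁) k₁ a₁ *_) (+-identityʳ _)) (sym (+-identityʳ _))

cutCount : ∀ j n₁ p k a → let n = suc (j + suc n₁) in
  ∑[ e ∈ I n p ] 𝟙 (isLS k a e ∧ (Rlar e ≡ᵇ n ∸ suc n₁)) ≡ rhsTerm n p k a (suc n₁)
cutCount j n₁ p k a = begin
  ∑[ e ∈ I (suc (j + suc n₁)) p ] 𝟙 (isLS k a e ∧ (Rlar e ≡ᵇ suc (j + suc n₁) ∸ suc n₁))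
    ≡⟨ cong (λ r → ∑[ e ∈ I (suc (j + suc n₁)) p ] 𝟙 (isLS k a e ∧ (Rlar e ≡ᵇ r))) length-x ⟩
  ∑[ e ∈ I (suc (j + suc n₁)) p ] F e
    ≡⟨ cong (λ B → ∑[ e ∈ box B ] F e) (Ibounds-split j (suc n₁) p) ⟩
  ∑[ e ∈ box (Bx ++ By) ] F e
    ≡⟨ sumBy-box-++ Bx By F ⟩
  ∑[ x ∈ box Bx ] ∑[ y ∈ box By ] F (x ++ y)
    ≡⟨ sumBy-congᴬ (All-length-box Bx) (λ x |x| → sumBy-congᴬ (All-length-box By) (λ y |y| → cut x y |x| |y|)) ⟩
  ∑[ x ∈ box Bx ] ∑[ y ∈ box By ] ∑[ k₁ < suc k ] ∑[ a₁ < suc a ] 𝟙 (isN k₁ a₁ y) * 𝟙 (isHead k a k₁ a₁ x)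
    ≡⟨ sumBy-cong (box Bx) (λ x →
         sumBy-∑<₂ (suc k) (suc a) (λ y k₁ a₁ → 𝟙 (isN k₁ a₁ y) * 𝟙 (isHead k a k₁ a₁ x)) (box By)) ⟩
  ∑[ x ∈ box Bx ] ∑[ k₁ < suc k ] ∑[ a₁ < suc a ] ∑[ y ∈ box By ] 𝟙 (isN k₁ a₁ y) * 𝟙 (isHead k a k₁ a₁ x)
    ≡⟨ sumBy-∑<₂ (suc k) (suc a) (λ x k₁ a₁ → ∑[ y ∈ box By ] 𝟙 (isN k₁ a₁ y) * 𝟙 (isHead k a k₁ a₁ x))
                 (box Bx) ⟩
  ∑[ k₁ < suc k ] ∑[ a₁ < suc a ] ∑[ x ∈ box Bx ] ∑[ y ∈ box By ] 𝟙 (isN k₁ a₁ y) * 𝟙 (isHead k a k₁ a₁ x)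
    ≡⟨ ∑<-cong (suc k) (λ k₁ _ → ∑<-cong (suc a) (λ a₁ _ →
         sumBy-product (λ x → 𝟙 (isHead k a k₁ a₁ x)) (λ y → 𝟙 (isN k₁ a₁ y)) (box Bx) (box By))) ⟩
  ∑[ k₁ < suc k ] ∑[ a₁ < suc a ] (∑[ y ∈ box By ] 𝟙 (isN k₁ a₁ y)) * (∑[ x ∈ box Bx ] 𝟙 (isHead k a k₁ a₁ x))
    ≡⟨ ∑<-cong (suc k) (λ k₁ _ → trans (∑<-cong (suc a) (λ a₁ _ → sumBy-cut-parts j n₁ p k a k₁ a₁))
                                        (sym (*-∑< (suc a) (𝟙 (k₁ ≤ᵇ p)) _))) ⟩
  ∑[ k₁ < suc k ] 𝟙 (k₁ ≤ᵇ p) * (∑[ a₁ < suc a ] countN (suc n₁) k₁ a₁ * countSL⁺ (suc j) (p ∸ k₁) (k ∸ k₁) (a ∸ a₁))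
    ≡⟨ cong (λ r → ∑[ k₁ < suc k ] 𝟙 (k₁ ≤ᵇ p) *
                     (∑[ a₁ < suc a ] countN (suc n₁) k₁ a₁ * countSL⁺ r (p ∸ k₁) (k ∸ k₁) (a ∸ a₁)))
            (sym length-x) ⟩
  rhsTerm (suc (j + suc n₁)) p k a (suc n₁) ∎
  where
  open ≡-Reasoning
  length-x : suc (j + suc n₁) ∸ suc n₁ ≡ suc j
  length-x = trans (cong (_∸ n₁) (+-suc j n₁)) (m+n∸n≡m (suc j) n₁)
  F : List ℕ → ℕ
  F e = 𝟙 (isLS k a e ∧ (Rlar e ≡ᵇ suc j))
  Bx By : List ℕ
  Bx = Ibounds (suc j) p
  By = Itail j (suc n₁) p
  cut : ∀ x y → length x ≡ length Bx → length y ≡ length By →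
        F (x ++ y) ≡ ∑[ k₁ < suc k ] ∑[ a₁ < suc a ] 𝟙 (isN k₁ a₁ y) * 𝟙 (isHead k a k₁ a₁ x)
  cut (x ∷ xs) (y ∷ ys) |x| _ = trans
    (cong (λ n → 𝟙 (isLS k a ((x ∷ xs) ++ y ∷ ys) ∧ (Rlar ((x ∷ xs) ++ y ∷ ys) ≡ᵇ n)))
          (sym (trans |x| (length-Ibounds j p))))
    (trans (cong 𝟙 (cut-LS≡isCut k a x xs y ys)) (isCut-as-sum k a (x ∷ xs) (y ∷ ys)))

𝟙-split : ∀ b r n → r ≤ n → 𝟙 b ≡ ∑[ n₁ < suc n ] 𝟙 (b ∧ (r ≡ᵇ n ∸ n₁))
𝟙-split b r n r≤n = sym (trans (∑<-single (suc n) (n ∸ r) (s≤s (m∸n≤m n r)) others) at-n∸r)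
  where
  at-n∸r : 𝟙 (b ∧ (r ≡ᵇ n ∸ (n ∸ r))) ≡ 𝟙 b
  at-n∸r rewrite m∸[m∸n]≡n r≤n | ≡ᵇ-refl r = cong 𝟙 (Boolₚ.∧-identityʳ b)
  others : ∀ i → i < suc n → i ≢ n ∸ r → 𝟙 (b ∧ (r ≡ᵇ n ∸ i)) ≡ 0
  others i i≤n i≢n∸r
    rewrite ≢⇒≡ᵇ-false {r} {n ∸ i} (λ r≡ → i≢n∸r (trans (sym (m∸[m∸n]≡n (s≤s⁻¹ i≤n))) (cong (n ∸_) (sym r≡))))
    = cong 𝟙 (Boolₚ.∧-zeroʳ b)

count-by-Rlar : ∀ k a n es → All (λ e → length e ≡ n) es →
  count (isLS k a) es ≡ ∑[ n₁ < suc n ] ∑[ e ∈ es ] 𝟙 (isLS k a e ∧ (Rlar e ≡ᵇ n ∸ n₁))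
count-by-Rlar k a n es |es| = trans (count≡sumBy (isLS k a) es)
  (trans (sumBy-congᴬ |es| (λ e |e| → 𝟙-split (isLS k a e) (Rlar e) n (subst (Rlar e ≤_) |e| (lastPos≤length (lar e) e))))
         (sumBy-∑< (suc n) _ es))

Rlar-LS<length : ∀ k a e → isLS k a e ≡ true → Rlar e < length e
Rlar-LS<length k a e isLS-e = <-≤-trans Rlar<Rsma (lastPos≤length (sma e) e)
  where
  Rlar<Rsma : Rlar e < Rsma e
  Rlar<Rsma = <ᵇ-true⇒< (proj₁ (∧-true-elim (Rlar e <ᵇ Rsma e) (proj₂ (∧-true-elim (avoids021 e) isLS-e))))

cutAtEnd : ∀ m p k a → ∑[ e ∈ I (suc m) p ] 𝟙 (isLS k a e ∧ (Rlar e ≡ᵇ suc m)) ≡ 0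
cutAtEnd m p k a = sumBy-zeroᴬ (All-length-box (Ibounds (suc m) p)) λ e |e| → cong 𝟙 (never e (trans |e| (length-Ibounds m p)))
  where
  never : ∀ e → length e ≡ suc m → (isLS k a e ∧ (Rlar e ≡ᵇ suc m)) ≡ false
  never e |e| with isLS k a e in isLS-e
  ... | false = refl
  ... | true  = ≢⇒≡ᵇ-false (<⇒≢ (subst (Rlar e <_) |e| (Rlar-LS<length k a e isLS-e)))

cutAtStart : ∀ m p k a → ∑[ e ∈ I (suc m) p ] 𝟙 (isLS k a e ∧ (Rlar e ≡ᵇ 0)) ≡ 0
cutAtStart m p k a = sumBy-zeroᴬ (All-length-box (Ibounds (suc m) p)) λ { (x ∷ xs) _ →
  cong 𝟙 (trans (cong (isLS k a (x ∷ xs) ∧_) (lastPos-occurs>0 _ (x ∷ xs) (occurs-lar x xs))) (Boolₚ.∧-zeroʳ _)) }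

rhsTerm-zero : ∀ n p k a n₁ →
  (∀ k₁ a₁ → countN n₁ k₁ a₁ * countSL⁺ (n ∸ n₁) (p ∸ k₁) (k ∸ k₁) (a ∸ a₁) ≡ 0) →
  rhsTerm n p k a n₁ ≡ 0
rhsTerm-zero n p k a n₁ h = ∑<-zero (suc k) (λ k₁ _ →
  trans (cong (𝟙 (k₁ ≤ᵇ p) *_) (∑<-zero (suc a) (λ a₁ _ → h k₁ a₁))) (*-zeroʳ (𝟙 (k₁ ≤ᵇ p))))

count-LS : ∀ m p k a → count (isLS k a) (I (suc m) p) ≡ rhsCoef (suc m) p k a
count-LS m p k a = trans (count-by-Rlar k a (suc m) (box B) |B|) (∑<-cong (suc (suc m)) term)
  where
  B = Ibounds (suc m) p
  |B| : All (λ e → length e ≡ suc m) (box B)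
  |B| = All.map (λ |e| → trans |e| (length-Ibounds m p)) (All-length-box B)
  cutAt : ℕ → ℕ → ℕ
  cutAt m′ n₁ = ∑[ e ∈ I (suc m′) p ] 𝟙 (isLS k a e ∧ (Rlar e ≡ᵇ suc m′ ∸ n₁))
  term : ∀ n₁ → n₁ < suc (suc m) → cutAt m n₁ ≡ rhsTerm (suc m) p k a n₁
  term zero _ = trans (cutAtEnd m p k a) (sym (rhsTerm-zero (suc m) p k a 0 (λ _ _ → refl)))
  term (suc n₁) n₁≤m with n₁ <? m
  ... | yes n₁<m = subst (λ m′ → cutAt m′ (suc n₁) ≡ rhsTerm (suc m′) p k a (suc n₁))
                         (m∸n+n≡m n₁<m) (cutCount (m ∸ suc n₁) n₁ p k a)
  ... | no  n₁≮m rewrite ≤-antisym (s≤s⁻¹ (s≤s⁻¹ n₁≤m)) (≮⇒≥ n₁≮m) =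
    trans (cong (λ r → ∑[ e ∈ box B ] 𝟙 (isLS k a e ∧ (Rlar e ≡ᵇ r))) (n∸n≡0 m))
          (trans (cutAtStart m p k a) (sym (rhsTerm-zero (suc m) p k a (suc m) (λ k₁ a₁ →
            trans (cong (λ r → countN (suc m) k₁ a₁ * countSL⁺ r (p ∸ k₁) (k ∸ k₁) (a ∸ a₁)) (n∸n≡0 m))
                  (*-zeroʳ (countN (suc m) k₁ a₁))))))

lar-zeros : ∀ n → lar (replicate n 0) ≡ 0
lar-zeros zero    = refl
lar-zeros (suc n) = lar-zeros n

asc-zeros : ∀ n → asc (replicate n 0) ≡ 0
asc-zeros zero          = refl
asc-zeros (suc zero)    = refl
asc-zeros (suc (suc n)) = asc-zeros (suc n)

contains021-zeros : ∀ n → contains021 (replicate n 0) ≡ false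
contains021-zeros zero    = refl
contains021-zeros (suc n) rewrite contains021-zeros n
  | pairFrom-below 0 (replicate n 0) (Allₚ.replicate⁺ n z≤n) = refl

sma-zeros : ∀ m → sma (replicate (suc m) 0) ≡ 0
sma-zeros zero    = refl
sma-zeros (suc m) = refl

isSL-zeros : ∀ m a → isSL 0 a (replicate (suc m) 0) ≡ (0 ≡ᵇ a)
isSL-zeros m a rewrite contains021-zeros (suc m) | sma-zeros m | lar-zeros (suc m) | asc-zeros (suc m)
  | ≤⇒≤ᵇ-true (≤-refl {lastPos 0 (replicate (suc m) 0)}) = refl

count-SL-lar0 : ∀ m q a → count (isSL 0 a) (I (suc m) (suc q)) ≡ 𝟙 (0 ≡ᵇ a)
count-SL-lar0 m q a = begin
  count (isSL 0 a) (box B)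
    ≡⟨ count≡sumBy (isSL 0 a) (box B) ⟩
  ∑[ e ∈ box B ] 𝟙 (isSL 0 a e)
    ≡⟨ sumBy-cong (box B) (λ e → cong 𝟙 (isSL-bounded 0 a e)) ⟩
  ∑[ e ∈ box B ] 𝟙 (all (_<ᵇ 1) e ∧ isSL 0 a e)
    ≡⟨ sumBy-box-below B 1 (isSL 0 a) ⟩
  ∑[ e ∈ box (map (_⊓ 1) B) ] 𝟙 (isSL 0 a e)
    ≡⟨ cong (λ B′ → ∑[ e ∈ box B′ ] 𝟙 (isSL 0 a e)) B⊓1 ⟩
  ∑[ e ∈ box (replicate (suc m) 1) ] 𝟙 (isSL 0 a e)
    ≡⟨ sumBy-box-ones (suc m) (λ e → 𝟙 (isSL 0 a e)) ⟩
  𝟙 (isSL 0 a (replicate (suc m) 0))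
    ≡⟨ cong 𝟙 (isSL-zeros m a) ⟩
  𝟙 (0 ≡ᵇ a) ∎
  where
  open ≡-Reasoning
  B = Ibounds (suc m) (suc q)
  B⊓1 : map (_⊓ 1) B ≡ replicate (suc m) 1
  B⊓1 = trans (map-⊓-≥ 1 B (s≤s z≤n ∷ Allₚ.map⁺ (All.universal (λ _ → s≤s z≤n) (upTo m))))
              (cong (λ n → replicate n 1) (length-Ibounds m (suc q)))

PSℕ : Set
PSℕ = ℕ → ℕ → ℕ → ℕ → ℕ

infixl 7 _⋆_

_⋆_ : PSℕ → PSℕ → PSℕ
(f ⋆ g) n p k a =
  ∑[ i < suc n ] ∑[ j < suc p ] ∑[ l < suc k ] ∑[ b < suc a ] f i j l b * g (n ∸ i) (p ∸ j) (k ∸ l) (a ∸ b)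

Σ≤-ℕ : ∀ n (f : ℕ → ℕ) → Σ≤ n (λ i → ℤ.+ f i) ≡ ℤ.+ (∑[ i < suc n ] f i)
Σ≤-ℕ n f = trans (foldr-ℕ (upTo (suc n))) (cong ℤ.+_ (sumBy-upTo (suc n) f))
  where
  foldr-ℕ : ∀ xs → foldr ℤ._+_ (ℤ.+ 0) (map (λ i → ℤ.+ f i) xs) ≡ ℤ.+ sumBy f xs
  foldr-ℕ []       = refl
  foldr-ℕ (x ∷ xs) rewrite foldr-ℕ xs = sym (ℤₚ.pos-+ (f x) (sumBy f xs))

Σ≤-cong : ∀ n {f g : ℕ → ℤ} → (∀ i → f i ≡ g i) → Σ≤ n f ≡ Σ≤ n g
Σ≤-cong n h = cong (foldr ℤ._+_ (ℤ.+ 0)) (Listₚ.map-cong h (upTo (suc n)))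

*ₚ-ℕ : ∀ {F G : PS} {f g : PSℕ} →
       (∀ n p k a → F n p k a ≡ ℤ.+ f n p k a) → (∀ n p k a → G n p k a ≡ ℤ.+ g n p k a) →
       ∀ n p k a → (F *ₚ G) n p k a ≡ ℤ.+ (f ⋆ g) n p k a
*ₚ-ℕ {F} {G} {f} {g} F≡f G≡g n p k a =
  trans (Σ≤-cong n (λ i → trans (Σ≤-cong p (λ j → trans (Σ≤-cong k (λ l → trans (Σ≤-cong a (λ b → term i j l b))
                                                                                  (Σ≤-ℕ a _)))
                                                          (Σ≤-ℕ k _)))
                                 (Σ≤-ℕ p _)))
        (Σ≤-ℕ n _)
  where
  term : ∀ i j l b → F i j l b ℤ.* G (n ∸ i) (p ∸ j) (k ∸ l) (a ∸ b)
                     ≡ ℤ.+ (f i j l b * g (n ∸ i) (p ∸ j) (k ∸ l) (a ∸ b))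
  term i j l b rewrite F≡f i j l b | G≡g (n ∸ i) (p ∸ j) (k ∸ l) (a ∸ b) =
    sym (ℤₚ.pos-* (f i j l b) (g (n ∸ i) (p ∸ j) (k ∸ l) (a ∸ b)))

-- xsℕ is x/(1-x) · s/(1-s) = Σ_{n,p ≥ 1} x^n s^p

xℕ sℕ xsℕ : PSℕ
xℕ zero    p       k       a       = 0
xℕ (suc n) (suc p) k       a       = 0
xℕ (suc n) zero    (suc k) a       = 0
xℕ (suc n) zero    zero    (suc a) = 0
xℕ (suc n) zero    zero    zero    = 1
sℕ (suc n) p       k       a       = 0
sℕ zero    zero    k       a       = 0
sℕ zero    (suc p) (suc k) a       = 0
sℕ zero    (suc p) zero    (suc a) = 0
sℕ zero    (suc p) zero    zero    = 1
xsℕ zero    p       k       a       = 0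
xsℕ (suc n) p       k       a       = sℕ 0 p k a

x/1-x-ℕ : ∀ n p k a → x/1-x n p k a ≡ ℤ.+ xℕ n p k a
x/1-x-ℕ zero    p       k       a       = refl
x/1-x-ℕ (suc n) (suc p) k       a       = refl
x/1-x-ℕ (suc n) zero    (suc k) a       = refl
x/1-x-ℕ (suc n) zero    zero    (suc a) = refl
x/1-x-ℕ (suc n) zero    zero    zero    = refl

s/1-s-ℕ : ∀ n p k a → s/1-s n p k a ≡ ℤ.+ sℕ n p k a
s/1-s-ℕ (suc n) p       k       a       = refl
s/1-s-ℕ zero    zero    k       a       = refl
s/1-s-ℕ zero    (suc p) (suc k) a       = refl
s/1-s-ℕ zero    (suc p) zero    (suc a) = refl
s/1-s-ℕ zero    (suc p) zero    zero    = refl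

xℕ-s : ∀ n p k a → xℕ n (suc p) k a ≡ 0
xℕ-s zero    p k a = refl
xℕ-s (suc n) p k a = refl

xℕ-k : ∀ n k a → xℕ n 0 (suc k) a ≡ 0
xℕ-k zero    k a = refl
xℕ-k (suc n) k a = refl

xℕ-a : ∀ n a → xℕ n 0 0 (suc a) ≡ 0
xℕ-a zero    a = refl
xℕ-a (suc n) a = refl

xℕ⋆sℕ : ∀ n p k a → (xℕ ⋆ sℕ) n p k a ≡ xsℕ n p k a
xℕ⋆sℕ n p k a = trans (∑<-cong (suc n) (λ i _ → only-x^i i)) (along-x n)
  where
  only-x^i : ∀ i → ∑[ j < suc p ] ∑[ l < suc k ] ∑[ b < suc a ] xℕ i j l b * sℕ (n ∸ i) (p ∸ j) (k ∸ l) (a ∸ b)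
                   ≡ xℕ i 0 0 0 * sℕ (n ∸ i) p k a
  only-x^i i =
    trans (∑<-cong (suc p) (λ j _ → ∑<-cong (suc k) (λ l _ →
             ∑<-head a _ (λ b → cong (_* sℕ (n ∸ i) (p ∸ j) (k ∸ l) (a ∸ suc b)) (xℕ-a′ j l b)))))
   (trans (∑<-cong (suc p) (λ j _ → ∑<-head k _ (λ l → cong (_* sℕ (n ∸ i) (p ∸ j) (k ∸ suc l) a) (xℕ-k′ j l))))
          (∑<-head p _ (λ j → cong (_* sℕ (n ∸ i) (p ∸ suc j) k a) (xℕ-s i j 0 0))))
    where
    xℕ-a′ : ∀ j l b → xℕ i j l (suc b) ≡ 0
    xℕ-a′ zero    zero    b = xℕ-a i b
    xℕ-a′ zero    (suc l) b = xℕ-k i l (suc b)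
    xℕ-a′ (suc j) l       b = xℕ-s i j l (suc b)
    xℕ-k′ : ∀ j l → xℕ i j (suc l) 0 ≡ 0
    xℕ-k′ zero    l = xℕ-k i l 0
    xℕ-k′ (suc j) l = xℕ-s i j (suc l) 0
  along-x : ∀ n → ∑[ i < suc n ] xℕ i 0 0 0 * sℕ (n ∸ i) p k a ≡ xsℕ n p k a
  along-x zero    = refl
  along-x (suc n) =
    trans (∑<-single (suc (suc n)) (suc n) ≤-refl others)
          (trans (+-identityʳ _) (cong (λ r → sℕ r p k a) (n∸n≡0 n)))
    where
    others : ∀ i → i < suc (suc n) → i ≢ suc n → xℕ i 0 0 0 * sℕ (suc n ∸ i) p k a ≡ 0
    others zero    _     _  = refl
    others (suc i) i≤1+n i≢ with suc n ∸ suc i in eq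
    ... | zero  = ⊥-elim (i≢ (cong suc (≤-antisym (s≤s⁻¹ (s≤s⁻¹ i≤1+n)) (m∸n≡0⇒m≤n eq))))
    ... | suc r = refl

𝒢*⁺-ℕ : ∀ n p k a → (𝒢* -ₚ x/1-x *ₚ s/1-s) n p k a ≡ ℤ.+ countSL⁺ n p k a
𝒢*⁺-ℕ n p k a rewrite *ₚ-ℕ x/1-x-ℕ s/1-s-ℕ n p k a | xℕ⋆sℕ n p k a = go n p k a
  where
  go : ∀ n p k a → 𝒢* n p k a ℤ.- ℤ.+ xsℕ n p k a ≡ ℤ.+ countSL⁺ n p k a
  go zero    p       k       a       = refl
  go (suc m) zero    k       a       = refl
  go (suc m) (suc q) (suc k) a       = ℤₚ.+-identityʳ _
  go (suc m) (suc q) zero    zero    rewrite count-SL-lar0 m q 0       = refl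
  go (suc m) (suc q) zero    (suc a) rewrite count-SL-lar0 m q (suc a) = refl

NusCoef : PSℕ
NusCoef n p k a = if p ≡ᵇ k then countN n k a else 0

𝒩us-ℕ : ∀ n p k a → 𝒩us n p k a ≡ ℤ.+ NusCoef n p k a
𝒩us-ℕ n p k a with p ≡ᵇ k
... | false = refl
𝒩us-ℕ zero    p k a | true = refl
𝒩us-ℕ (suc m) p k a | true = refl

NusCoef-off : ∀ n₁ a₁ {p₁ k₁} → p₁ ≢ k₁ → NusCoef n₁ p₁ k₁ a₁ ≡ 0
NusCoef-off n₁ a₁ p₁≢k₁ rewrite ≢⇒≡ᵇ-false p₁≢k₁ = refl

NusCoef-diag : ∀ n₁ k₁ a₁ → NusCoef n₁ k₁ k₁ a₁ ≡ countN n₁ k₁ a₁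
NusCoef-diag n₁ k₁ a₁ rewrite ≡ᵇ-refl k₁ = refl

NusCoef⋆countSL⁺ : ∀ n p k a → (NusCoef ⋆ countSL⁺) n p k a ≡ rhsCoef n p k a
NusCoef⋆countSL⁺ n p k a =
  ∑<-cong (suc n) (λ n₁ _ → trans (∑<-comm (suc p) (suc k) _) (∑<-cong (suc k) (λ k₁ _ → diagonal n₁ k₁)))
  where
  term : ℕ → ℕ → ℕ → ℕ → ℕ
  term n₁ p₁ k₁ a₁ = NusCoef n₁ p₁ k₁ a₁ * countSL⁺ (n ∸ n₁) (p ∸ p₁) (k ∸ k₁) (a ∸ a₁)
  diagonal : ∀ n₁ k₁ → ∑[ p₁ < suc p ] ∑[ a₁ < suc a ] term n₁ p₁ k₁ a₁
             ≡ 𝟙 (k₁ ≤ᵇ p) * (∑[ a₁ < suc a ] countN n₁ k₁ a₁ * countSL⁺ (n ∸ n₁) (p ∸ k₁) (k ∸ k₁) (a ∸ a₁))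
  diagonal n₁ k₁ = trans
    (∑<-≤-single p k₁ _ (λ p₁ p₁≢k₁ → ∑<-zero (suc a) (λ a₁ _ →
      cong (_* countSL⁺ (n ∸ n₁) (p ∸ p₁) (k ∸ k₁) (a ∸ a₁)) (NusCoef-off n₁ a₁ p₁≢k₁))))
    (cong (𝟙 (k₁ ≤ᵇ p) *_) (∑<-cong (suc a) (λ a₁ _ →
      cong (_* countSL⁺ (n ∸ n₁) (p ∸ k₁) (k ∸ k₁) (a ∸ a₁)) (NusCoef-diag n₁ k₁ a₁))))

𝒢**-ℕ : ∀ n p k a → 𝒢** n p k a ≡ ℤ.+ rhsCoef n p k a
𝒢**-ℕ zero    p       k a = cong ℤ.+_ (sym (rhsTerm-zero 0 p k a 0 (λ _ _ → refl)))
𝒢**-ℕ (suc m) zero    k a = cong ℤ.+_ (count-LS m 0 k a)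
𝒢**-ℕ (suc m) (suc q) k a = cong ℤ.+_ (count-LS m (suc q) k a)

mainTheorem12 : ∀ n p k a →
    𝒢** n p k a ≡ (𝒩us *ₚ (𝒢* -ₚ x/1-x *ₚ s/1-s)) n p k a
mainTheorem12 n p k a = begin
  𝒢** n p k a                                   ≡⟨ 𝒢**-ℕ n p k a ⟩
  ℤ.+ rhsCoef n p k a                           ≡⟨ cong ℤ.+_ (NusCoef⋆countSL⁺ n p k a) ⟨
  ℤ.+ (NusCoef ⋆ countSL⁺) n p k a              ≡⟨ *ₚ-ℕ 𝒩us-ℕ 𝒢*⁺-ℕ n p k a ⟨
  (𝒩us *ₚ (𝒢* -ₚ x/1-x *ₚ s/1-s)) n p k a      ∎
  where open ≡-Reasoning
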